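{- For every integer $d\ge4$ there exists a $d$-dimensional integral polytope $\mathcal{P}$ such that the coefficients of $t$ and $t^2$ in $i(\mathcal{P},t)$ are negative and the coefficients of $t^3,t^4,\dots,t^{d-2}$ in $i(\mathcal{P},t)$ are positive.
   Context: An integral polytope is a convex polytope all of whose vertices have integer coordinates. For an integral polytope $\mathcal{P}\subseteq\mathbb{R}^N$ of dimension $d$, $i(\mathcal{P},t)=|t\mathcal{P}\cap\mathbb{Z}^N|$ ($t$ a positive integer) is a polynomial in $t$ of degree $d$, the Ehrhart polynomial. -}

module Defs where

open import Data.Nat as ℕ using (ℕ; zero; suc)
open import Data.Integer as ℤ using (ℤ; +_)
open import Data.Rational using (ℚ; _/_; 0ℚ; 1ℚ; _+_; _*_; _≤_)
open import Data.Fin using (Fin; zero; suc)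
open import Data.Vec using (Vec; lookup)
open import Data.List using (List; length)
open import Data.List.Membership.Propositional using (_∈_)
open import Data.List.Relation.Unary.Unique.Propositional using (Unique)
open import Data.Product using (Σ; ∃; _×_)
open import Function using (_∘_)
open import Relation.Binary.PropositionalEquality using (_≡_)
open import Relation.Nullary using (¬_)

ℤ→ℚ : ℤ → ℚ
ℤ→ℚ z = z / 1

ℕ→ℚ : ℕ → ℚ
ℕ→ℚ n = ℤ→ℚ (+ n)

sumQ : {n : ℕ} → (Fin n → ℚ) → ℚ
sumQ {zero}  f = 0ℚ
sumQ {suc n} f = f zero + sumQ (f ∘ suc)

powQ : ℚ → ℕ → ℚ
powQ q zero    = 1ℚ
powQ q (suc k) = q * powQ q k

polyEval : ℕ → (ℕ → ℚ) → ℚ → ℚ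
polyEval zero    c t = c 0
polyEval (suc d) c t = polyEval d c t + c (suc d) * powQ t (suc d)

Point : ℕ → Set
Point N = Vec ℤ N

-- An integral polytope in ℝ^N: the convex hull of finitely many
-- (m) integer points gens 0, …, gens (m-1).
record IntPolytope (N : ℕ) : Set where
  field
    m    : ℕ
    gens : Fin m → Point N
open IntPolytope public

-- x ∈ t·P  (for an integer point x): x = Σ λ_i v_i with λ_i ≥ 0 rational
-- and Σ λ_i = t.  (Rational coefficients suffice since all data is rational.)
InDilate : {N : ℕ} → IntPolytope N → ℕ → Point N → Set
InDilate P t x =
  Σ (Fin (m P) → ℚ) λ lam →
    (∀ i → 0ℚ ≤ lam i) ×
    (sumQ lam ≡ ℕ→ℚ t) ×
    (∀ k → sumQ (λ i → lam i * ℤ→ℚ (lookup (gens P i) k)) ≡ ℤ→ℚ (lookup x k))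

LatticeCount : {N : ℕ} → IntPolytope N → ℕ → ℚ → Set
LatticeCount P t q =
  Σ (List (Point _)) λ L →
    Unique L ×
    (∀ x → (x ∈ L → InDilate P t x) × (InDilate P t x → x ∈ L)) ×
    (ℕ→ℚ (length L) ≡ q)

AffIndep : {N k : ℕ} → (Fin k → Point N) → Set
AffIndep {N} {k} p =
  (c : Fin k → ℚ) → sumQ c ≡ 0ℚ →
  (∀ j → sumQ (λ i → c i * ℤ→ℚ (lookup (p i) j)) ≡ 0ℚ) →
  ∀ i → c i ≡ 0ℚ

HasDim : {N : ℕ} → IntPolytope N → ℕ → Set
HasDim P d =
  (Σ (Fin (suc d) → Fin (m P)) λ f → AffIndep (gens P ∘ f)) ×
  (∀ (f : Fin (suc (suc d)) → Fin (m P)) → ¬ AffIndep (gens P ∘ f))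

IsEhrhartPoly : {N : ℕ} → IntPolytope N → ℕ → (ℕ → ℚ) → Set
IsEhrhartPoly P d c = ∀ t → 1 ℕ.≤ t → LatticeCount P t (polyEval d c (ℕ→ℚ t))

-- Let 𝒜 ⊂ ℝ⁴ be the simplex with vertices 0, e₁ + e₂ + 60e₃, e₁, e₂ and e₄. Splitting the
-- lattice points of T𝒜 according to x₃ mod 60 identifies them with the lattice points of the
-- standard simplex TΔ₄ (residue 0) and of 59 copies of (T − 2)Δ₄ (nonzero residues), whence
--   24 · i(𝒜, T) = 24 − 68T − 24T² + 128T³ + 60T⁴.
-- For d = 4 + K let n = K + 1 and P = n𝒜 × [0,1]ᴷ. Dilating by n substitutes T = nt and every
-- prism factor multiplies the Ehrhart polynomial by 1 + t, so 24 times the coefficient of tʲ is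
--   24·C(K,j) − 68n·C(K,j−1) − 24n²·C(K,j−2) + 128n³·C(K,j−3) + 60n⁴·C(K,j−4).
-- The negative terms dominate for j = 1, 2. For 3 ≤ j ≤ K + 2, C(K, m + 1) ≤ K·C(K, m) bounds
-- the negative part by 92n³·C(K,j−3) < 128n³·C(K,j−3). Finally P is d-dimensional: 𝒜 is a
-- 4-simplex, each prism adds a dimension, and no d + 2 points of ℤᵈ are affinely independent.

module Submission where

open import Defs
open import Algebra.Bundles using (Ring)
import Algebra.Properties.Semiring.Sum as SemiringSum
open import Data.Fin as Fin using (Fin; zero; suc; toℕ; punchIn; _↑ˡ_; _↑ʳ_)
import Data.Fin.Properties as FinP
open import Data.Fin.Patterns using (0F; 1F; 2F; 3F; 4F)
open import Data.Integer as ℤ using (ℤ; +_; -[1+_])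
import Data.Integer.Properties as ℤP
import Data.Integer.Tactic.RingSolver as ℤSolver
open import Data.List as List using (List; [_]; map; length; cartesianProductWith; allFin; upTo)
import Data.List.Properties as ListP
open import Data.List.Membership.Propositional using (_∈_)
open import Data.List.Membership.Propositional.Properties
  using (∈-map⁺; ∈-map⁻; ∈-++⁺ˡ; ∈-++⁺ʳ; ∈-++⁻; ∈-upTo⁺; ∈-upTo⁻; ∈-allFin;
         ∈-cartesianProductWith⁺; ∈-cartesianProductWith⁻)
open import Data.List.Relation.Unary.All using ([])
open import Data.List.Relation.Unary.AllPairs using ([]; _∷_)
open import Data.List.Relation.Unary.Any using (here)
open import Data.List.Relation.Unary.Unique.Propositional using (Unique)
import Data.List.Relation.Unary.Unique.Propositional.Properties as UniqueP
open import Data.Maybe using (Maybe; just; nothing)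
open import Data.Nat as ℕ using (ℕ; zero; suc; z≤n; s≤s)
open import Data.Nat.Combinatorics using (_C_; nCk+nC[k+1]≡[n+1]C[k+1]; nC1≡n; k>n⇒nCk≡0)
open import Data.Nat.Coprimality using (1-coprimeTo)
import Data.Nat.Coprimality as Coprime
open import Data.Nat.DivMod using (_%_; _divMod_; result; [m+kn]%n≡m%n; m<n⇒m%n≡m)
import Data.Nat.Properties as ℕP
import Data.Nat.Tactic.RingSolver as ℕSolver
open import Data.Product using (Σ; _×_; _,_; proj₁; proj₂)
open import Data.Rational as Rational using (ℚ)
import Data.Rational.Properties as ℚP
open import Data.Sum using (inj₁; inj₂)
open import Data.Vec as Vec using (Vec; []; _∷_; lookup)
import Data.Vec.Properties as VecP
open import Data.Vec.Functional.Properties using (insertAt-lookup; insertAt-punchIn; lookup-++ˡ; lookup-++ʳ)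
import Data.Vec.Functional.Relation.Unary.All.Properties as AllP
open import Function using (_∘_; _⇔_; mk⇔; Equivalence)
open import Level using (0ℓ)
open import Relation.Binary.PropositionalEquality
  using (_≡_; refl; cong; cong₂; trans; sym; subst; subst₂; module ≡-Reasoning)
open import Relation.Nullary using (¬_; yes; no; ¬?)
open import Relation.Nullary.Decidable using (decidable-stable)
open import Tactic.RingSolver using (solve-∀)
open import Tactic.RingSolver.Core.AlmostCommutativeRing using (AlmostCommutativeRing; fromCommutativeRing)

module _ where
  open import Data.Rational using (mkℚ; _/_; 0ℚ; 1ℚ; _+_; _*_; _-_; -_; 1/_; _≤_; _<_; NonZero)
  open import Data.Vec.Functional using (_++_; insertAt; removeAt)
  open ≡-Reasoning

  ℚ-ring : AlmostCommutativeRing 0ℓ 0ℓ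
  ℚ-ring = fromCommutativeRing ℚP.+-*-commutativeRing isZero
    where
    isZero : ∀ x → Maybe (0ℚ ≡ x)
    isZero x with 0ℚ ℚP.≟ x
    ... | yes 0≡x = just 0≡x
    ... | no _    = nothing

  ℤ→ℚ≡mkℚ : ∀ z → ℤ→ℚ z ≡ mkℚ z 0 (Coprime.sym (1-coprimeTo _))
  ℤ→ℚ≡mkℚ (+ n)    = ℚP.normalize-coprime (Coprime.sym (1-coprimeTo n))
  ℤ→ℚ≡mkℚ -[1+ n ] = cong -_ (ℚP.normalize-coprime (Coprime.sym (1-coprimeTo (suc n))))

  ℤ→ℚ-homo-+ : ∀ a b → ℤ→ℚ (a ℤ.+ b) ≡ ℤ→ℚ a + ℤ→ℚ b
  ℤ→ℚ-homo-+ a b = trans (cong (_/ 1) (+-with-unit-denominators a b))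
                         (sym (cong₂ _+_ (ℤ→ℚ≡mkℚ a) (ℤ→ℚ≡mkℚ b)))
    where
    +-with-unit-denominators : ∀ a b → a ℤ.+ b ≡ a ℤ.* + 1 ℤ.+ b ℤ.* + 1
    +-with-unit-denominators = ℤSolver.solve-∀

  ℤ→ℚ-homo-* : ∀ a b → ℤ→ℚ (a ℤ.* b) ≡ ℤ→ℚ a * ℤ→ℚ b
  ℤ→ℚ-homo-* a b = sym (cong₂ _*_ (ℤ→ℚ≡mkℚ a) (ℤ→ℚ≡mkℚ b))

  ℤ→ℚ-homo-neg : ∀ a → ℤ→ℚ (ℤ.- a) ≡ - ℤ→ℚ a
  ℤ→ℚ-homo-neg (+ zero)  = refl
  ℤ→ℚ-homo-neg (+ suc n) = refl
  ℤ→ℚ-homo-neg -[1+ n ]  = neg-involutive (ℤ→ℚ (+ suc n))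
    where
    neg-involutive : ∀ x → x ≡ - (- x)
    neg-involutive = solve-∀ ℚ-ring

  ℤ→ℚ-homo-sub : ∀ a b → ℤ→ℚ (a ℤ.- b) ≡ ℤ→ℚ a - ℤ→ℚ b
  ℤ→ℚ-homo-sub a b = trans (ℤ→ℚ-homo-+ a (ℤ.- b)) (cong (_+_ (ℤ→ℚ a)) (ℤ→ℚ-homo-neg b))

  ℕ→ℚ-homo-+ : ∀ a b → ℕ→ℚ (a ℕ.+ b) ≡ ℕ→ℚ a + ℕ→ℚ b
  ℕ→ℚ-homo-+ a b = ℤ→ℚ-homo-+ (+ a) (+ b)

  ℕ→ℚ-homo-* : ∀ a b → ℕ→ℚ (a ℕ.* b) ≡ ℕ→ℚ a * ℕ→ℚ b
  ℕ→ℚ-homo-* a b = trans (cong ℤ→ℚ (ℤP.pos-* a b)) (ℤ→ℚ-homo-* (+ a) (+ b))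

  ℤ→ℚ-mono-≤ : ∀ {a b} → a ℤ.≤ b → ℤ→ℚ a ≤ ℤ→ℚ b
  ℤ→ℚ-mono-≤ {a} {b} a≤b rewrite ℤ→ℚ≡mkℚ a | ℤ→ℚ≡mkℚ b =
    Rational.*≤* (subst₂ ℤ._≤_ (sym (ℤP.*-identityʳ a)) (sym (ℤP.*-identityʳ b)) a≤b)

  ℤ→ℚ-cancel-≤ : ∀ {a b} → ℤ→ℚ a ≤ ℤ→ℚ b → a ℤ.≤ b
  ℤ→ℚ-cancel-≤ {a} {b} a≤b rewrite ℤ→ℚ≡mkℚ a | ℤ→ℚ≡mkℚ b =
    subst₂ ℤ._≤_ (ℤP.*-identityʳ a) (ℤP.*-identityʳ b) (ℚP.drop-*≤* a≤b)

  ℤ→ℚ-mono-< : ∀ {a b} → a ℤ.< b → ℤ→ℚ a < ℤ→ℚ b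
  ℤ→ℚ-mono-< {a} {b} a<b rewrite ℤ→ℚ≡mkℚ a | ℤ→ℚ≡mkℚ b =
    Rational.*<* (subst₂ ℤ._<_ (sym (ℤP.*-identityʳ a)) (sym (ℤP.*-identityʳ b)) a<b)

  ℕ→ℚ-mono-< : ∀ {a b} → a ℕ.< b → ℕ→ℚ a < ℕ→ℚ b
  ℕ→ℚ-mono-< {a} {b} a<b = ℤ→ℚ-mono-< {+ a} {+ b} (ℤ.+<+ a<b)

  ℕ→ℚ-nonNeg : ∀ a → 0ℚ ≤ ℕ→ℚ a
  ℕ→ℚ-nonNeg a = ℤ→ℚ-mono-≤ {+ 0} {+ a} (ℤ.+≤+ ℕ.z≤n)

  module ΣQ = SemiringSum (Ring.semiring ℚP.+-*-ring)

  sumQ≡sum : ∀ {n} (f : Fin n → ℚ) → sumQ f ≡ ΣQ.sum f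
  sumQ≡sum {zero}  f = refl
  sumQ≡sum {suc n} f = cong (_+_ (f zero)) (sumQ≡sum (f ∘ suc))

  sumQ-cong : ∀ {n} {f g : Fin n → ℚ} → (∀ i → f i ≡ g i) → sumQ f ≡ sumQ g
  sumQ-cong {f = f} {g} f≗g =
    trans (sumQ≡sum f) (trans (ΣQ.sum-cong-≗ f≗g) (sym (sumQ≡sum g)))

  sumQ-distrib-+ : ∀ {n} (f g : Fin n → ℚ) → sumQ (λ i → f i + g i) ≡ sumQ f + sumQ g
  sumQ-distrib-+ f g = trans (sumQ≡sum (λ i → f i + g i)) (trans (ΣQ.∑-distrib-+ f g)
    (sym (cong₂ _+_ (sumQ≡sum f) (sumQ≡sum g))))

  *-distribˡ-sumQ : ∀ {n} a (f : Fin n → ℚ) → a * sumQ f ≡ sumQ (λ i → a * f i)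
  *-distribˡ-sumQ a f = trans (cong (a *_) (sumQ≡sum f))
    (trans (ΣQ.*-distribˡ-sum a f) (sym (sumQ≡sum (λ i → a * f i))))

  *-distribʳ-sumQ : ∀ {n} a (f : Fin n → ℚ) → sumQ f * a ≡ sumQ (λ i → f i * a)
  *-distribʳ-sumQ a f = trans (cong (_* a) (sumQ≡sum f))
    (trans (ΣQ.*-distribʳ-sum a f) (sym (sumQ≡sum (λ i → f i * a))))

  sumQ-zero : ∀ n → sumQ {n} (λ _ → 0ℚ) ≡ 0ℚ
  sumQ-zero n = trans (sumQ≡sum {n} (λ _ → 0ℚ)) (ΣQ.sum-replicate-zero n)

  sumQ-remove : ∀ {n} (i : Fin (suc n)) (f : Fin (suc n) → ℚ) →
                sumQ f ≡ f i + sumQ (f ∘ punchIn i)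
  sumQ-remove i f = trans (sumQ≡sum f) (trans (ΣQ.sum-remove f)
    (sym (cong (_+_ (f i)) (sumQ≡sum (removeAt f i)))))

  sumQ-++ : ∀ m {n} (f : Fin (m ℕ.+ n) → ℚ) →
            sumQ f ≡ sumQ (f ∘ (_↑ˡ n)) + sumQ (f ∘ (m ↑ʳ_))
  sumQ-++ zero    f = sym (ℚP.+-identityˡ _)
  sumQ-++ (suc m) f = trans (cong (_+_ (f zero)) (sumQ-++ m (f ∘ suc))) (sym (ℚP.+-assoc (f zero) _ _))

  sumQ-mono-≤ : ∀ {n} {f g : Fin n → ℚ} → (∀ i → f i ≤ g i) → sumQ f ≤ sumQ g
  sumQ-mono-≤ {zero}  f≤g = ℚP.≤-refl
  sumQ-mono-≤ {suc n} f≤g = ℚP.+-mono-≤ (f≤g zero) (sumQ-mono-≤ (f≤g ∘ suc))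

  sumQ-nonNeg : ∀ {n} {f : Fin n → ℚ} → (∀ i → 0ℚ ≤ f i) → 0ℚ ≤ sumQ f
  sumQ-nonNeg {n} {f} 0≤f = subst (_≤ sumQ f) (sumQ-zero n) (sumQ-mono-≤ 0≤f)

  *-nonNeg : ∀ {a b} → 0ℚ ≤ a → 0ℚ ≤ b → 0ℚ ≤ a * b
  *-nonNeg {a} {b} 0≤a 0≤b = ℚP.nonNegative⁻¹ (a * b)
    {{ℚP.nonNeg*nonNeg⇒nonNeg a {{Rational.nonNegative 0≤a}} b {{Rational.nonNegative 0≤b}}}}

  ℕ→ℚ-nonZero : ∀ n .{{_ : ℕ.NonZero n}} → NonZero (ℕ→ℚ n)
  ℕ→ℚ-nonZero n = Rational.≢-nonZero λ n≡0 → ℚP.<-irrefl (sym n≡0) (ℕ→ℚ-mono-< (ℕ.>-nonZero⁻¹ n))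

  1/ℕ→ℚ-nonNeg : ∀ n .{{_ : ℕ.NonZero n}} → 0ℚ ≤ (1/ ℕ→ℚ n) {{ℕ→ℚ-nonZero n}}
  1/ℕ→ℚ-nonNeg n = ℚP.<⇒≤ (ℚP.positive⁻¹ _
    {{ℚP.1/pos⇒pos (ℕ→ℚ n) {{Rational.positive (ℕ→ℚ-mono-< (ℕ.>-nonZero⁻¹ n))}}}})

  *-cancelˡ-≡0 : ∀ a .{{_ : NonZero a}} {x} → a * x ≡ 0ℚ → x ≡ 0ℚ
  *-cancelˡ-≡0 a {x} a·x≡0 = begin
    x                 ≡⟨ ℚP.*-identityˡ x ⟨
    1ℚ * x            ≡⟨ cong (_* x) (ℚP.*-inverseˡ a) ⟨
    1/ a * a * x      ≡⟨ ℚP.*-assoc (1/ a) a x ⟩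
    1/ a * (a * x)    ≡⟨ cong (1/ a *_) a·x≡0 ⟩
    1/ a * 0ℚ         ≡⟨ ℚP.*-zeroʳ (1/ a) ⟩
    0ℚ                ∎

  sumQ-linear : ∀ {n} (f g : Fin n → ℚ) r → sumQ (λ i → f i + r * g i) ≡ sumQ f + r * sumQ g
  sumQ-linear f g r =
    trans (sumQ-distrib-+ f (λ i → r * g i)) (cong (_+_ (sumQ f)) (sym (*-distribˡ-sumQ r g)))

  -- Affine dependence

  LinearDependence : ∀ {m n} → (Fin m → Fin n → ℚ) → Set
  LinearDependence {m} {n} v =
    Σ (Fin m → ℚ) λ c → ¬ (∀ i → c i ≡ 0ℚ) × (∀ j → sumQ (λ i → c i * v i j) ≡ 0ℚ)

  linearDependence-column₀≡0 : ∀ {n} (v : Fin (suc (suc n)) → Fin (suc n) → ℚ) → (∀ k → v k zero ≡ 0ℚ) →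
                               LinearDependence (λ i j → v (suc i) (suc j)) → LinearDependence v
  linearDependence-column₀≡0 {n} v column₀≡0 (c′ , c′≢0 , c′·v≡0) = c , c≢0 , c·v≡0
    where
    c : Fin (suc (suc n)) → ℚ
    c zero    = 0ℚ
    c (suc i) = c′ i
    c≢0 : ¬ (∀ i → c i ≡ 0ℚ)
    c≢0 c≡0 = c′≢0 (c≡0 ∘ suc)
    c·v≡0 : ∀ j → sumQ (λ i → c i * v i j) ≡ 0ℚ
    c·v≡0 zero = begin
      0ℚ * v zero zero + sumQ (λ i → c′ i * v (suc i) zero)
        ≡⟨ cong₂ _+_ (ℚP.*-zeroˡ (v zero zero)) (sumQ-cong λ i →
             trans (cong (c′ i *_) (column₀≡0 (suc i))) (ℚP.*-zeroʳ (c′ i))) ⟩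
      0ℚ + sumQ {suc n} (λ _ → 0ℚ)
        ≡⟨ trans (ℚP.+-identityˡ _) (sumQ-zero (suc n)) ⟩
      0ℚ ∎
    c·v≡0 (suc j) = trans (cong₂ _+_ (ℚP.*-zeroˡ (v zero (suc j))) (c′·v≡0 j)) (ℚP.+-identityˡ 0ℚ)

  eliminateColumn₀ : ∀ {n} (v : Fin (suc (suc n)) → Fin (suc n) → ℚ) k .{{_ : NonZero (v k zero)}} →
                     Fin (suc n) → Fin n → ℚ
  eliminateColumn₀ v k i j = v (punchIn k i) (suc j) - v (punchIn k i) zero * 1/ v k zero * v k (suc j)

  linearDependence-pivot : ∀ {n} (v : Fin (suc (suc n)) → Fin (suc n) → ℚ) k .{{_ : NonZero (v k zero)}} →
                           LinearDependence (eliminateColumn₀ v k) → LinearDependence v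
  linearDependence-pivot v k (c′ , c′≢0 , c′·w≡0) = c , c≢0 , c·v≡0
    where
    a S cₖ : ℚ
    a  = v k zero
    S  = sumQ (λ i → c′ i * v (punchIn k i) zero)
    cₖ = - (S * 1/ a)
    c : Fin _ → ℚ
    c = insertAt c′ k cₖ
    c≢0 : ¬ (∀ i → c i ≡ 0ℚ)
    c≢0 c≡0 = c′≢0 λ i → trans (sym (insertAt-punchIn c′ k cₖ i)) (c≡0 (punchIn k i))
    split : ∀ j → sumQ (λ i → c i * v i j) ≡ cₖ * v k j + sumQ (λ i → c′ i * v (punchIn k i) j)
    split j = trans (sumQ-remove k (λ i → c i * v i j)) (cong₂ _+_
      (cong (_* v k j) (insertAt-lookup c′ k cₖ))
      (sumQ-cong λ i → cong (_* v (punchIn k i) j) (insertAt-punchIn c′ k cₖ i)))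
    c·v≡0 : ∀ j → sumQ (λ i → c i * v i j) ≡ 0ℚ
    c·v≡0 zero = begin
      sumQ (λ i → c i * v i zero)  ≡⟨ split zero ⟩
      - (S * 1/ a) * a + S         ≡⟨ pivot S (1/ a) a ⟩
      S * (1ℚ - 1/ a * a)          ≡⟨ cong (λ x → S * (1ℚ - x)) (ℚP.*-inverseˡ a) ⟩
      S * (1ℚ - 1ℚ)                ≡⟨ trans (cong (S *_) (ℚP.+-inverseʳ 1ℚ)) (ℚP.*-zeroʳ S) ⟩
      0ℚ                           ∎
      where
      pivot : ∀ S u a → - (S * u) * a + S ≡ S * (1ℚ - u * a)
      pivot = solve-∀ ℚ-ring
    c·v≡0 (suc j) = begin
      sumQ (λ i → c i * v i (suc j))
        ≡⟨ split (suc j) ⟩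
      - (S * 1/ a) * b + sumQ (λ i → c′ i * x i)
        ≡⟨ reorder S (1/ a) b (sumQ (λ i → c′ i * x i)) ⟩
      sumQ (λ i → c′ i * x i) + - (1/ a * b) * S
        ≡⟨ sumQ-linear (λ i → c′ i * x i) (λ i → c′ i * v (punchIn k i) zero) (- (1/ a * b)) ⟨
      sumQ (λ i → c′ i * x i + - (1/ a * b) * (c′ i * v (punchIn k i) zero))
        ≡⟨ sumQ-cong (λ i → eliminate (c′ i) (x i) (v (punchIn k i) zero) (1/ a) b) ⟨
      sumQ (λ i → c′ i * eliminateColumn₀ v k i j)
        ≡⟨ c′·w≡0 j ⟩
      0ℚ ∎
      where
      b : ℚ
      b = v k (suc j)
      x : Fin _ → ℚ
      x i = v (punchIn k i) (suc j)
      reorder : ∀ S u b T → - (S * u) * b + T ≡ T + - (u * b) * S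
      reorder = solve-∀ ℚ-ring
      eliminate : ∀ c x y u b → c * (x - y * u * b) ≡ c * x + - (u * b) * (c * y)
      eliminate = solve-∀ ℚ-ring

  linearDependence : ∀ n (v : Fin (suc n) → Fin n → ℚ) → LinearDependence v
  linearDependence zero    v = (λ _ → 1ℚ) , (λ c≡0 → ℚP.1≢0 (c≡0 zero)) , λ ()
  linearDependence (suc n) v with FinP.any? (λ k → ¬? (v k zero ℚP.≟ 0ℚ))
  ... | yes (k , vₖ₀≢0) = linearDependence-pivot v k {{Rational.≢-nonZero vₖ₀≢0}}
                            (linearDependence n (eliminateColumn₀ v k {{Rational.≢-nonZero vₖ₀≢0}}))
  ... | no noPivot = linearDependence-column₀≡0 v
                       (λ k → decidable-stable (v k zero ℚP.≟ 0ℚ) (λ vₖ₀≢0 → noPivot (k , vₖ₀≢0)))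
                       (linearDependence n (λ i j → v (suc i) (suc j)))

  homogenise : ∀ {m d} → (Fin m → Point d) → Fin m → Fin (suc d) → ℚ
  homogenise p i zero    = 1ℚ
  homogenise p i (suc j) = ℤ→ℚ (lookup (p i) j)

  ¬AffIndep-d+2-points : ∀ d (p : Fin (suc (suc d)) → Point d) → ¬ AffIndep p
  ¬AffIndep-d+2-points d p indep with linearDependence (suc d) (homogenise p)
  ... | c , c≢0 , c·p̂≡0 = c≢0 (indep c Σc≡0 (c·p̂≡0 ∘ suc))
    where
    Σc≡0 : sumQ c ≡ 0ℚ
    Σc≡0 = trans (sumQ-cong (λ i → sym (ℚP.*-identityʳ (c i)))) (c·p̂≡0 zero)

  -- Dilates and prisms

  latticeCount-cong : ∀ {N} {P Q : IntPolytope N} {s t q} →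
                      (∀ x → InDilate P s x ⇔ InDilate Q t x) → LatticeCount P s q → LatticeCount Q t q
  latticeCount-cong P⇔Q (L , unique , enumerates , length≡q) =
    L , unique , (λ x → Equivalence.to (P⇔Q x) ∘ proj₁ (enumerates x) ,
                        proj₂ (enumerates x) ∘ Equivalence.from (P⇔Q x)) , length≡q

  dilate : ∀ {N} → ℕ → IntPolytope N → IntPolytope N
  dilate n P = record { m = m P ; gens = λ i → Vec.map (+ n ℤ.*_) (gens P i) }

  module _ {N} (n : ℕ) .{{_ : ℕ.NonZero n}} (P : IntPolytope N) where

    private
      instance
        n-nonZero : NonZero (ℕ→ℚ n)
        n-nonZero = ℕ→ℚ-nonZero n

    ℤ→ℚ-lookup-dilate : ∀ i k →
      ℤ→ℚ (lookup (gens (dilate n P) i) k) ≡ ℕ→ℚ n * ℤ→ℚ (lookup (gens P i) k)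
    ℤ→ℚ-lookup-dilate i k = trans (cong ℤ→ℚ (VecP.lookup-map k (+ n ℤ.*_) (gens P i)))
                                  (ℤ→ℚ-homo-* (+ n) (lookup (gens P i) k))

    sumQ-gens-dilate : ∀ (lam : Fin (m P) → ℚ) k →
      sumQ (λ i → lam i * ℤ→ℚ (lookup (gens (dilate n P) i) k)) ≡
      sumQ (λ i → lam i * ℕ→ℚ n * ℤ→ℚ (lookup (gens P i) k))
    sumQ-gens-dilate lam k = sumQ-cong λ i →
      trans (cong (lam i *_) (ℤ→ℚ-lookup-dilate i k)) (sym (ℚP.*-assoc (lam i) _ _))

    inDilate-dilate : ∀ t x → InDilate P (n ℕ.* t) x ⇔ InDilate (dilate n P) t x
    inDilate-dilate t x = mk⇔ from to
      where
      to : InDilate (dilate n P) t x → InDilate P (n ℕ.* t) x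
      to (lam , 0≤lam , Σlam≡t , Σlam·v≡x) =
        (λ i → lam i * ℕ→ℚ n) ,
        (λ i → *-nonNeg (0≤lam i) (ℕ→ℚ-nonNeg n)) ,
        (begin
          sumQ (λ i → lam i * ℕ→ℚ n) ≡⟨ *-distribʳ-sumQ (ℕ→ℚ n) lam ⟨
          sumQ lam * ℕ→ℚ n           ≡⟨ cong (_* ℕ→ℚ n) Σlam≡t ⟩
          ℕ→ℚ t * ℕ→ℚ n              ≡⟨ ℚP.*-comm (ℕ→ℚ t) (ℕ→ℚ n) ⟩
          ℕ→ℚ n * ℕ→ℚ t              ≡⟨ ℕ→ℚ-homo-* n t ⟨
          ℕ→ℚ (n ℕ.* t)              ∎) ,
        λ k → trans (sym (sumQ-gens-dilate lam k)) (Σlam·v≡x k)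
      from : InDilate P (n ℕ.* t) x → InDilate (dilate n P) t x
      from (lam , 0≤lam , Σlam≡nt , Σlam·v≡x) =
        lam/n ,
        (λ i → *-nonNeg (0≤lam i) (1/ℕ→ℚ-nonNeg n)) ,
        (begin
          sumQ lam/n                            ≡⟨ *-distribʳ-sumQ (1/ ℕ→ℚ n) lam ⟨
          sumQ lam * 1/ ℕ→ℚ n                   ≡⟨ cong (_* 1/ ℕ→ℚ n) (trans Σlam≡nt (ℕ→ℚ-homo-* n t)) ⟩
          ℕ→ℚ n * ℕ→ℚ t * 1/ ℕ→ℚ n              ≡⟨ cancel (ℕ→ℚ n) (ℕ→ℚ t) (1/ ℕ→ℚ n) ⟩
          ℕ→ℚ n * 1/ ℕ→ℚ n * ℕ→ℚ t              ≡⟨ cong (_* ℕ→ℚ t) (ℚP.*-inverseʳ (ℕ→ℚ n)) ⟩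
          1ℚ * ℕ→ℚ t                            ≡⟨ ℚP.*-identityˡ _ ⟩
          ℕ→ℚ t                                 ∎) ,
        λ k → trans (sumQ-gens-dilate lam/n k)
                    (trans (sumQ-cong λ i → cong (_* _) (lam/n·n≡lam i)) (Σlam·v≡x k))
        where
        lam/n : Fin (m P) → ℚ
        lam/n i = lam i * 1/ ℕ→ℚ n
        cancel : ∀ a b c → a * b * c ≡ a * c * b
        cancel = solve-∀ ℚ-ring
        lam/n·n≡lam : ∀ i → lam/n i * ℕ→ℚ n ≡ lam i
        lam/n·n≡lam i = begin
          lam i * 1/ ℕ→ℚ n * ℕ→ℚ n    ≡⟨ ℚP.*-assoc (lam i) _ _ ⟩
          lam i * (1/ ℕ→ℚ n * ℕ→ℚ n)  ≡⟨ cong (lam i *_) (ℚP.*-inverseˡ (ℕ→ℚ n)) ⟩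
          lam i * 1ℚ                  ≡⟨ ℚP.*-identityʳ (lam i) ⟩
          lam i                       ∎

    affIndep-dilate : ∀ {k} (f : Fin k → Fin (m P)) →
                      AffIndep (gens P ∘ f) → AffIndep (gens (dilate n P) ∘ f)
    affIndep-dilate f indep c Σc≡0 Σc·nv≡0 = indep c Σc≡0 λ j → *-cancelˡ-≡0 (ℕ→ℚ n) (begin
      ℕ→ℚ n * sumQ (λ i → c i * v i j)                ≡⟨ *-distribˡ-sumQ (ℕ→ℚ n) (λ i → c i * v i j) ⟩
      sumQ (λ i → ℕ→ℚ n * (c i * v i j))              ≡⟨ sumQ-cong (λ i → swap (c i) (ℕ→ℚ n) (v i j)) ⟨
      sumQ (λ i → c i * (ℕ→ℚ n * v i j))              ≡⟨ sumQ-cong (λ i → cong (c i *_) (ℤ→ℚ-lookup-dilate (f i) j)) ⟨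
      sumQ (λ i → c i * ℤ→ℚ (lookup (gens (dilate n P) (f i)) j)) ≡⟨ Σc·nv≡0 j ⟩
      0ℚ                                              ∎)
      where
      v : Fin _ → Fin N → ℚ
      v i j = ℤ→ℚ (lookup (gens P (f i)) j)
      swap : ∀ a b c → a * (b * c) ≡ b * (a * c)
      swap = solve-∀ ℚ-ring

  length-cartesianProductWith : ∀ {A B C : Set} (f : A → B → C) xs ys →
    length (cartesianProductWith f xs ys) ≡ length xs ℕ.* length ys
  length-cartesianProductWith f List.[]       ys = refl
  length-cartesianProductWith f (x List.∷ xs) ys = begin
    length (List.map (f x) ys List.++ cartesianProductWith f xs ys)
      ≡⟨ ListP.length-++ (List.map (f x) ys) ⟩
    length (List.map (f x) ys) ℕ.+ length (cartesianProductWith f xs ys)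
      ≡⟨ cong₂ ℕ._+_ (ListP.length-map (f x) ys) (length-cartesianProductWith f xs ys) ⟩
    length ys ℕ.+ length xs ℕ.* length ys ∎

  prism : ∀ {N} → IntPolytope N → IntPolytope (suc N)
  prism P = record
    { m    = m P ℕ.+ m P
    ; gens = (λ i → + 0 ∷ gens P i) ++ (λ i → + 1 ∷ gens P i)
    }

  module _ (t : ℕ) .{{_ : ℕ.NonZero t}} (a : ℤ) where

    private
      instance
        t-nonZero : NonZero (ℕ→ℚ t)
        t-nonZero = ℕ→ℚ-nonZero t

    bottomWeight topWeight : ℚ
    bottomWeight = ℤ→ℚ (+ t ℤ.- a) * 1/ ℕ→ℚ t
    topWeight    = ℤ→ℚ a * 1/ ℕ→ℚ t

    bottomWeight+topWeight≡1 : bottomWeight + topWeight ≡ 1ℚ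
    bottomWeight+topWeight≡1 = begin
      ℤ→ℚ (+ t ℤ.- a) * 1/ T + A * 1/ T  ≡⟨ cong (λ d → d * 1/ T + A * 1/ T) (ℤ→ℚ-homo-sub (+ t) a) ⟩
      (T - A) * 1/ T + A * 1/ T          ≡⟨ collect T A (1/ T) ⟩
      T * 1/ T                           ≡⟨ ℚP.*-inverseʳ T ⟩
      1ℚ                                 ∎
      where
      T A : ℚ
      T = ℕ→ℚ t
      A = ℤ→ℚ a
      collect : ∀ T A u → (T - A) * u + A * u ≡ T * u
      collect = solve-∀ ℚ-ring

    t·topWeight≡a : ℕ→ℚ t * topWeight ≡ ℤ→ℚ a
    t·topWeight≡a = begin
      T * (ℤ→ℚ a * 1/ T)  ≡⟨ regroup T (ℤ→ℚ a) (1/ T) ⟩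
      T * 1/ T * ℤ→ℚ a    ≡⟨ cong (_* ℤ→ℚ a) (ℚP.*-inverseʳ T) ⟩
      1ℚ * ℤ→ℚ a          ≡⟨ ℚP.*-identityˡ (ℤ→ℚ a) ⟩
      ℤ→ℚ a               ∎
      where
      T : ℚ
      T = ℕ→ℚ t
      regroup : ∀ T A u → T * (A * u) ≡ T * u * A
      regroup = solve-∀ ℚ-ring

  module _ {N} (P : IntPolytope N) where

    private
      M : ℕ
      M = m P
      v : Fin M → Fin N → ℚ
      v i k = ℤ→ℚ (lookup (gens P i) k)

    bottom-gen : ∀ i → gens (prism P) (i ↑ˡ M) ≡ + 0 ∷ gens P i
    bottom-gen = lookup-++ˡ (λ i → + 0 ∷ gens P i) (λ i → + 1 ∷ gens P i)

    top-gen : ∀ i → gens (prism P) (M ↑ʳ i) ≡ + 1 ∷ gens P i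
    top-gen = lookup-++ʳ (λ i → + 0 ∷ gens P i) (λ i → + 1 ∷ gens P i)

    sumQ-gens-prism : ∀ (lam : Fin (M ℕ.+ M) → ℚ) k →
      sumQ (λ j → lam j * ℤ→ℚ (lookup (gens (prism P) j) k)) ≡
      sumQ (λ i → lam (i ↑ˡ M) * ℤ→ℚ (lookup (+ 0 ∷ gens P i) k)) +
      sumQ (λ i → lam (M ↑ʳ i) * ℤ→ℚ (lookup (+ 1 ∷ gens P i) k))
    sumQ-gens-prism lam k = trans (sumQ-++ M _) (cong₂ _+_
      (sumQ-cong λ i → cong (λ p → lam (i ↑ˡ M) * ℤ→ℚ (lookup p k)) (bottom-gen i))
      (sumQ-cong λ i → cong (λ p → lam (M ↑ʳ i) * ℤ→ℚ (lookup p k)) (top-gen i)))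

    height-prism : ∀ (lam : Fin (M ℕ.+ M) → ℚ) →
      sumQ (λ j → lam j * ℤ→ℚ (lookup (gens (prism P) j) zero)) ≡ sumQ (λ i → lam (M ↑ʳ i))
    height-prism lam = begin
      _ ≡⟨ sumQ-gens-prism lam zero ⟩
      sumQ (λ i → lam (i ↑ˡ M) * 0ℚ) + sumQ (λ i → lam (M ↑ʳ i) * 1ℚ)
        ≡⟨ cong₂ _+_ (trans (sumQ-cong λ i → ℚP.*-zeroʳ (lam (i ↑ˡ M))) (sumQ-zero M))
                     (sumQ-cong λ i → ℚP.*-identityʳ (lam (M ↑ʳ i))) ⟩
      0ℚ + sumQ (λ i → lam (M ↑ʳ i))
        ≡⟨ ℚP.+-identityˡ _ ⟩
      sumQ (λ i → lam (M ↑ʳ i)) ∎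

    base-prism : ∀ (lam : Fin (M ℕ.+ M) → ℚ) k →
      sumQ (λ j → lam j * ℤ→ℚ (lookup (gens (prism P) j) (suc k))) ≡
      sumQ (λ i → (lam (i ↑ˡ M) + lam (M ↑ʳ i)) * v i k)
    base-prism lam k = begin
      _ ≡⟨ sumQ-gens-prism lam (suc k) ⟩
      sumQ (λ i → lam (i ↑ˡ M) * v i k) + sumQ (λ i → lam (M ↑ʳ i) * v i k)
        ≡⟨ sumQ-distrib-+ (λ i → lam (i ↑ˡ M) * v i k) (λ i → lam (M ↑ʳ i) * v i k) ⟨
      sumQ (λ i → lam (i ↑ˡ M) * v i k + lam (M ↑ʳ i) * v i k)
        ≡⟨ sumQ-cong (λ i → ℚP.*-distribʳ-+ (v i k) (lam (i ↑ˡ M)) (lam (M ↑ʳ i))) ⟨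
      sumQ (λ i → (lam (i ↑ˡ M) + lam (M ↑ʳ i)) * v i k) ∎

    inDilate-prism⁻ : ∀ {t a x} → InDilate (prism P) t (a ∷ x) →
                      InDilate P t x × + 0 ℤ.≤ a × a ℤ.≤ + t
    inDilate-prism⁻ {t} {a} {x} (lam , 0≤lam , Σlam≡t , Σlam·v≡ax) =
      (lam′ , 0≤lam′ , Σlam′≡t , Σlam′·v≡x) , 0≤a , a≤t
      where
      bottom top lam′ : Fin M → ℚ
      bottom i = lam (i ↑ˡ M)
      top    i = lam (M ↑ʳ i)
      lam′   i = bottom i + top i
      0≤lam′ : ∀ i → 0ℚ ≤ lam′ i
      0≤lam′ i = ℚP.+-mono-≤ (0≤lam (i ↑ˡ M)) (0≤lam (M ↑ʳ i))
      Σbottom+Σtop≡t : sumQ bottom + sumQ top ≡ ℕ→ℚ t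
      Σbottom+Σtop≡t = trans (sym (sumQ-++ M lam)) Σlam≡t
      Σlam′≡t : sumQ lam′ ≡ ℕ→ℚ t
      Σlam′≡t = trans (sumQ-distrib-+ bottom top) Σbottom+Σtop≡t
      Σlam′·v≡x : ∀ k → sumQ (λ i → lam′ i * v i k) ≡ ℤ→ℚ (lookup x k)
      Σlam′·v≡x k = trans (sym (base-prism lam k)) (Σlam·v≡ax (suc k))
      Σtop≡a : sumQ top ≡ ℤ→ℚ a
      Σtop≡a = trans (sym (height-prism lam)) (Σlam·v≡ax zero)
      0≤a : + 0 ℤ.≤ a
      0≤a = ℤ→ℚ-cancel-≤ (subst (0ℚ ≤_) Σtop≡a (sumQ-nonNeg (0≤lam ∘ (M ↑ʳ_))))
      a≤t : a ℤ.≤ + t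
      a≤t = ℤ→ℚ-cancel-≤ (subst₂ _≤_ (trans (ℚP.+-identityˡ _) Σtop≡a) Σbottom+Σtop≡t
              (ℚP.+-monoˡ-≤ (sumQ top) (sumQ-nonNeg (0≤lam ∘ (_↑ˡ M)))))

    inDilate-prism⁺ : ∀ {t a x} → 1 ℕ.≤ t → + 0 ℤ.≤ a → a ℤ.≤ + t →
                      InDilate P t x → InDilate (prism P) t (a ∷ x)
    inDilate-prism⁺ {t} {a} {x} 1≤t 0≤a a≤t (lam , 0≤lam , Σlam≡t , Σlam·v≡x) =
      lam′ , AllP.++⁺ (0ℚ ≤_) (λ i → *-nonNeg (0≤lam i) 0≤β) (λ i → *-nonNeg (0≤lam i) 0≤α) ,
      Σlam′≡t , Σlam′·v≡ax
      where
      instance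
        t-nonZero : ℕ.NonZero t
        t-nonZero = ℕ.>-nonZero 1≤t
      β α : ℚ
      β = bottomWeight t a
      α = topWeight t a
      0≤β : 0ℚ ≤ β
      0≤β = *-nonNeg (ℤ→ℚ-mono-≤ (ℤP.i≤j⇒0≤j-i a≤t)) (1/ℕ→ℚ-nonNeg t)
      0≤α : 0ℚ ≤ α
      0≤α = *-nonNeg (ℤ→ℚ-mono-≤ 0≤a) (1/ℕ→ℚ-nonNeg t)
      lam′ : Fin (M ℕ.+ M) → ℚ
      lam′ = (λ i → lam i * β) ++ (λ i → lam i * α)
      bottom : ∀ i → lam′ (i ↑ˡ M) ≡ lam i * β
      bottom = lookup-++ˡ (λ i → lam i * β) (λ i → lam i * α)
      top : ∀ i → lam′ (M ↑ʳ i) ≡ lam i * α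
      top = lookup-++ʳ (λ i → lam i * β) (λ i → lam i * α)
      split : ∀ i → lam i * β + lam i * α ≡ lam i
      split i = trans (sym (ℚP.*-distribˡ-+ (lam i) β α))
                      (trans (cong (lam i *_) (bottomWeight+topWeight≡1 t a)) (ℚP.*-identityʳ (lam i)))
      Σlam′≡t : sumQ lam′ ≡ ℕ→ℚ t
      Σlam′≡t = begin
        sumQ lam′                                       ≡⟨ sumQ-++ M lam′ ⟩
        sumQ (lam′ ∘ (_↑ˡ M)) + sumQ (lam′ ∘ (M ↑ʳ_))   ≡⟨ cong₂ _+_ (sumQ-cong bottom) (sumQ-cong top) ⟩
        sumQ (λ i → lam i * β) + sumQ (λ i → lam i * α) ≡⟨ sumQ-distrib-+ (λ i → lam i * β) (λ i → lam i * α) ⟨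
        sumQ (λ i → lam i * β + lam i * α)              ≡⟨ sumQ-cong split ⟩
        sumQ lam                                        ≡⟨ Σlam≡t ⟩
        ℕ→ℚ t                                           ∎
      Σlam′·v≡ax : ∀ k → sumQ (λ j → lam′ j * ℤ→ℚ (lookup (gens (prism P) j) k)) ≡ ℤ→ℚ (lookup (a ∷ x) k)
      Σlam′·v≡ax zero = begin
        _                          ≡⟨ height-prism lam′ ⟩
        sumQ (λ i → lam′ (M ↑ʳ i)) ≡⟨ sumQ-cong top ⟩
        sumQ (λ i → lam i * α)     ≡⟨ *-distribʳ-sumQ α lam ⟨
        sumQ lam * α               ≡⟨ cong (_* α) Σlam≡t ⟩
        ℕ→ℚ t * α                  ≡⟨ t·topWeight≡a t a ⟩
        ℤ→ℚ a                      ∎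
      Σlam′·v≡ax (suc k) = begin
        _ ≡⟨ base-prism lam′ k ⟩
        sumQ (λ i → (lam′ (i ↑ˡ M) + lam′ (M ↑ʳ i)) * v i k)
          ≡⟨ sumQ-cong (λ i → cong (_* v i k) (trans (cong₂ _+_ (bottom i) (top i)) (split i))) ⟩
        sumQ (λ i → lam i * v i k) ≡⟨ Σlam·v≡x k ⟩
        ℤ→ℚ (lookup x k) ∎

    latticeCount-prism : ∀ {t q} → 1 ℕ.≤ t → LatticeCount P t q →
                         LatticeCount (prism P) t (q * (1ℚ + ℕ→ℚ t))
    latticeCount-prism {t} {q} 1≤t (L , unique , enumerates , |L|≡q) =
      L′ , unique′ , enumerates′ , |L′|≡q·[1+t]
      where
      heights : List ℤ
      heights = List.map +_ (upTo (suc t))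
      L′ : List (Point (suc N))
      L′ = cartesianProductWith _∷_ heights L
      unique′ : Unique L′
      unique′ = UniqueP.cartesianProductWith⁺ _∷_ VecP.∷-injective
                  (UniqueP.map⁺ ℤP.+-injective (UniqueP.upTo⁺ (suc t))) unique
      ∈heights⁻ : ∀ {a} → a ∈ heights → + 0 ℤ.≤ a × a ℤ.≤ + t
      ∈heights⁻ a∈ with ∈-map⁻ +_ a∈
      ... | i , i∈ , refl = ℤ.+≤+ ℕ.z≤n , ℤ.+≤+ (ℕ.s≤s⁻¹ (∈-upTo⁻ i∈))
      ∈heights⁺ : ∀ {a} → + 0 ℤ.≤ a → a ℤ.≤ + t → a ∈ heights
      ∈heights⁺ (ℤ.+≤+ _) (ℤ.+≤+ i≤t) = ∈-map⁺ +_ (∈-upTo⁺ (ℕ.s≤s i≤t))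
      enumerates′ : ∀ y → (y ∈ L′ → InDilate (prism P) t y) × (InDilate (prism P) t y → y ∈ L′)
      enumerates′ (a ∷ x) = to , from
        where
        to : a ∷ x ∈ L′ → InDilate (prism P) t (a ∷ x)
        to ax∈ with ∈-cartesianProductWith⁻ _∷_ heights L ax∈
        ... | a , x , a∈ , x∈ , refl =
          inDilate-prism⁺ 1≤t (proj₁ (∈heights⁻ a∈)) (proj₂ (∈heights⁻ a∈)) (proj₁ (enumerates x) x∈)
        from : InDilate (prism P) t (a ∷ x) → a ∷ x ∈ L′
        from ax∈ with inDilate-prism⁻ ax∈
        ... | x∈ , 0≤a , a≤t = ∈-cartesianProductWith⁺ _∷_ (∈heights⁺ 0≤a a≤t) (proj₂ (enumerates x) x∈)
      |L′|≡q·[1+t] : ℕ→ℚ (length L′) ≡ q * (1ℚ + ℕ→ℚ t)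
      |L′|≡q·[1+t] = begin
        ℕ→ℚ (length L′)                       ≡⟨ cong ℕ→ℚ (length-cartesianProductWith _∷_ heights L) ⟩
        ℕ→ℚ (length heights ℕ.* length L)     ≡⟨ cong (λ h → ℕ→ℚ (h ℕ.* length L)) |heights|≡1+t ⟩
        ℕ→ℚ (suc t ℕ.* length L)              ≡⟨ ℕ→ℚ-homo-* (suc t) (length L) ⟩
        ℕ→ℚ (suc t) * ℕ→ℚ (length L)          ≡⟨ cong₂ _*_ (ℕ→ℚ-homo-+ 1 t) |L|≡q ⟩
        (1ℚ + ℕ→ℚ t) * q                      ≡⟨ ℚP.*-comm _ q ⟩
        q * (1ℚ + ℕ→ℚ t)                      ∎
        where
        |heights|≡1+t : length heights ≡ suc t
        |heights|≡1+t = trans (ListP.length-map +_ (upTo (suc t))) (ListP.length-upTo (suc t))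

    prismLift : ∀ {d} → (Fin (suc d) → Fin M) → Fin (suc (suc d)) → Fin (M ℕ.+ M)
    prismLift f zero    = M ↑ʳ f zero
    prismLift f (suc i) = f i ↑ˡ M

    affIndep-prism : ∀ {d} (f : Fin (suc d) → Fin M) →
                     AffIndep (gens P ∘ f) → AffIndep (gens (prism P) ∘ prismLift f)
    affIndep-prism {d} f indep c Σc≡0 Σc·q≡0 = c≡0
      where
      q : Fin (suc (suc d)) → Fin (suc N) → ℚ
      q i k = ℤ→ℚ (lookup (gens (prism P) (prismLift f i)) k)
      height≡c₀ : sumQ (λ i → c i * q i zero) ≡ c zero
      height≡c₀ = begin
        c zero * q zero zero + sumQ (λ i → c (suc i) * q (suc i) zero)
          ≡⟨ cong₂ _+_ (cong (λ p → c zero * ℤ→ℚ (lookup p zero)) (top-gen (f zero)))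
                       (sumQ-cong λ i → cong (λ p → c (suc i) * ℤ→ℚ (lookup p zero)) (bottom-gen (f i))) ⟩
        c zero * 1ℚ + sumQ (λ i → c (suc i) * 0ℚ)
          ≡⟨ cong₂ _+_ (ℚP.*-identityʳ (c zero))
                       (trans (sumQ-cong (λ i → ℚP.*-zeroʳ (c (suc i)))) (sumQ-zero (suc d))) ⟩
        c zero + 0ℚ
          ≡⟨ ℚP.+-identityʳ (c zero) ⟩
        c zero ∎
      c₀≡0 : c zero ≡ 0ℚ
      c₀≡0 = trans (sym height≡c₀) (Σc·q≡0 zero)
      Σc′≡0 : sumQ (c ∘ suc) ≡ 0ℚ
      Σc′≡0 = trans (sym (ℚP.+-identityˡ _)) (trans (cong (_+ sumQ (c ∘ suc)) (sym c₀≡0)) Σc≡0)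
      Σc′·p≡0 : ∀ k → sumQ (λ i → c (suc i) * ℤ→ℚ (lookup (gens P (f i)) k)) ≡ 0ℚ
      Σc′·p≡0 k = begin
        sumQ (λ i → c (suc i) * ℤ→ℚ (lookup (gens P (f i)) k))
          ≡⟨ ℚP.+-identityˡ _ ⟨
        0ℚ + sumQ (λ i → c (suc i) * ℤ→ℚ (lookup (gens P (f i)) k))
          ≡⟨ cong₂ _+_ (sym (trans (cong (_* q zero (suc k)) c₀≡0) (ℚP.*-zeroˡ (q zero (suc k)))))
                       (sumQ-cong λ i → cong (λ p → c (suc i) * ℤ→ℚ (lookup p (suc k))) (sym (bottom-gen (f i)))) ⟩
        sumQ (λ i → c i * q i (suc k))
          ≡⟨ Σc·q≡0 (suc k) ⟩
        0ℚ ∎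
      c≡0 : ∀ i → c i ≡ 0ℚ
      c≡0 zero    = c₀≡0
      c≡0 (suc i) = indep (c ∘ suc) Σc′≡0 Σc′·p≡0 i

  -- The simplex 𝒜

  vertex : Fin 5 → Point 4
  vertex 0F = + 0 ∷ + 0 ∷ + 0  ∷ + 0 ∷ []
  vertex 1F = + 1 ∷ + 1 ∷ + 60 ∷ + 0 ∷ []
  vertex 2F = + 1 ∷ + 0 ∷ + 0  ∷ + 0 ∷ []
  vertex 3F = + 0 ∷ + 1 ∷ + 0  ∷ + 0 ∷ []
  vertex 4F = + 0 ∷ + 0 ∷ + 0  ∷ + 1 ∷ []

  𝒜 : IntPolytope 4
  𝒜 = record { m = 5 ; gens = vertex }

  -- facet i T x is 60 times the i-th barycentric coordinate of x with respect to T𝒜.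
  facet : Fin 5 → ℕ → Point 4 → ℤ
  facet 0F T (x₁ ∷ x₂ ∷ x₃ ∷ x₄ ∷ []) = + 60 ℤ.* (+ T ℤ.- x₁ ℤ.- x₂ ℤ.- x₄) ℤ.+ x₃
  facet 1F T (x₁ ∷ x₂ ∷ x₃ ∷ x₄ ∷ []) = x₃
  facet 2F T (x₁ ∷ x₂ ∷ x₃ ∷ x₄ ∷ []) = + 60 ℤ.* x₁ ℤ.- x₃
  facet 3F T (x₁ ∷ x₂ ∷ x₃ ∷ x₄ ∷ []) = + 60 ℤ.* x₂ ℤ.- x₃
  facet 4F T (x₁ ∷ x₂ ∷ x₃ ∷ x₄ ∷ []) = + 60 ℤ.* x₄

  60ℚ : ℚ
  60ℚ = ℕ→ℚ 60

  facetℚ : Fin 5 → ℚ → (Fin 4 → ℚ) → ℚ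
  facetℚ 0F T x = 60ℚ * (T - x 0F - x 1F - x 3F) + x 2F
  facetℚ 1F T x = x 2F
  facetℚ 2F T x = 60ℚ * x 0F - x 2F
  facetℚ 3F T x = 60ℚ * x 1F - x 2F
  facetℚ 4F T x = 60ℚ * x 3F

  facetℚ-cong : ∀ i {S T} {x y : Fin 4 → ℚ} → S ≡ T → (∀ k → x k ≡ y k) → facetℚ i S x ≡ facetℚ i T y
  facetℚ-cong 0F S≡T x≗y = cong₂ _+_
    (cong (60ℚ *_) (cong₂ _-_ (cong₂ _-_ (cong₂ _-_ S≡T (x≗y 0F)) (x≗y 1F)) (x≗y 3F))) (x≗y 2F)
  facetℚ-cong 1F S≡T x≗y = x≗y 2F
  facetℚ-cong 2F S≡T x≗y = cong₂ _-_ (cong (60ℚ *_) (x≗y 0F)) (x≗y 2F)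
  facetℚ-cong 3F S≡T x≗y = cong₂ _-_ (cong (60ℚ *_) (x≗y 1F)) (x≗y 2F)
  facetℚ-cong 4F S≡T x≗y = cong (60ℚ *_) (x≗y 3F)

  ℤ→ℚ-facet : ∀ i T x → ℤ→ℚ (facet i T x) ≡ facetℚ i (ℕ→ℚ T) (ℤ→ℚ ∘ lookup x)
  ℤ→ℚ-facet 0F T (x₁ ∷ x₂ ∷ x₃ ∷ x₄ ∷ []) = begin
    ℤ→ℚ (+ 60 ℤ.* (+ T ℤ.- x₁ ℤ.- x₂ ℤ.- x₄) ℤ.+ x₃)
      ≡⟨ ℤ→ℚ-homo-+ (+ 60 ℤ.* (+ T ℤ.- x₁ ℤ.- x₂ ℤ.- x₄)) x₃ ⟩
    ℤ→ℚ (+ 60 ℤ.* (+ T ℤ.- x₁ ℤ.- x₂ ℤ.- x₄)) + ℤ→ℚ x₃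
      ≡⟨ cong (_+ ℤ→ℚ x₃) (ℤ→ℚ-homo-* (+ 60) (+ T ℤ.- x₁ ℤ.- x₂ ℤ.- x₄)) ⟩
    60ℚ * ℤ→ℚ (+ T ℤ.- x₁ ℤ.- x₂ ℤ.- x₄) + ℤ→ℚ x₃
      ≡⟨ cong (λ z → 60ℚ * z + ℤ→ℚ x₃) (trans (ℤ→ℚ-homo-sub (+ T ℤ.- x₁ ℤ.- x₂) x₄) (cong (_- ℤ→ℚ x₄)
           (trans (ℤ→ℚ-homo-sub (+ T ℤ.- x₁) x₂) (cong (_- ℤ→ℚ x₂) (ℤ→ℚ-homo-sub (+ T) x₁))))) ⟩
    60ℚ * (ℕ→ℚ T - ℤ→ℚ x₁ - ℤ→ℚ x₂ - ℤ→ℚ x₄) + ℤ→ℚ x₃ ∎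
  ℤ→ℚ-facet 1F T (x₁ ∷ x₂ ∷ x₃ ∷ x₄ ∷ []) = refl
  ℤ→ℚ-facet 2F T (x₁ ∷ x₂ ∷ x₃ ∷ x₄ ∷ []) =
    trans (ℤ→ℚ-homo-sub (+ 60 ℤ.* x₁) x₃) (cong (_- ℤ→ℚ x₃) (ℤ→ℚ-homo-* (+ 60) x₁))
  ℤ→ℚ-facet 3F T (x₁ ∷ x₂ ∷ x₃ ∷ x₄ ∷ []) =
    trans (ℤ→ℚ-homo-sub (+ 60 ℤ.* x₂) x₃) (cong (_- ℤ→ℚ x₃) (ℤ→ℚ-homo-* (+ 60) x₂))
  ℤ→ℚ-facet 4F T (x₁ ∷ x₂ ∷ x₃ ∷ x₄ ∷ []) = ℤ→ℚ-homo-* (+ 60) x₄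

  combination : (Fin 5 → ℚ) → Fin 4 → ℚ
  combination lam 0F = lam 1F + lam 2F
  combination lam 1F = lam 1F + lam 3F
  combination lam 2F = 60ℚ * lam 1F
  combination lam 3F = lam 4F

  sumQ-vertex : ∀ lam k → sumQ (λ i → lam i * ℤ→ℚ (lookup (vertex i) k)) ≡ combination lam k
  sumQ-vertex lam 0F = x₁-coordinate (lam 0F) (lam 1F) (lam 2F) (lam 3F) (lam 4F)
    where
    x₁-coordinate : ∀ a b c d e → a * 0ℚ + (b * 1ℚ + (c * 1ℚ + (d * 0ℚ + (e * 0ℚ + 0ℚ)))) ≡ b + c
    x₁-coordinate = solve-∀ ℚ-ring
  sumQ-vertex lam 1F = x₂-coordinate (lam 0F) (lam 1F) (lam 2F) (lam 3F) (lam 4F)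
    where
    x₂-coordinate : ∀ a b c d e → a * 0ℚ + (b * 1ℚ + (c * 0ℚ + (d * 1ℚ + (e * 0ℚ + 0ℚ)))) ≡ b + d
    x₂-coordinate = solve-∀ ℚ-ring
  sumQ-vertex lam 2F = x₃-coordinate (lam 0F) (lam 1F) (lam 2F) (lam 3F) (lam 4F)
    where
    x₃-coordinate : ∀ a b c d e → a * 0ℚ + (b * 60ℚ + (c * 0ℚ + (d * 0ℚ + (e * 0ℚ + 0ℚ)))) ≡ 60ℚ * b
    x₃-coordinate = solve-∀ ℚ-ring
  sumQ-vertex lam 3F = x₄-coordinate (lam 0F) (lam 1F) (lam 2F) (lam 3F) (lam 4F)
    where
    x₄-coordinate : ∀ a b c d e → a * 0ℚ + (b * 0ℚ + (c * 0ℚ + (d * 0ℚ + (e * 1ℚ + 0ℚ)))) ≡ e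
    x₄-coordinate = solve-∀ ℚ-ring

  facetℚ-combination : ∀ i lam → facetℚ i (sumQ lam) (combination lam) ≡ 60ℚ * lam i
  facetℚ-combination 0F lam = cancel (lam 0F) (lam 1F) (lam 2F) (lam 3F) (lam 4F)
    where
    cancel : ∀ a b c d e → 60ℚ * ((a + (b + (c + (d + (e + 0ℚ))))) - (b + c) - (b + d) - e) + 60ℚ * b ≡ 60ℚ * a
    cancel = solve-∀ ℚ-ring
  facetℚ-combination 1F lam = refl
  facetℚ-combination 2F lam = cancel (lam 1F) (lam 2F)
    where
    cancel : ∀ b c → 60ℚ * (b + c) - 60ℚ * b ≡ 60ℚ * c
    cancel = solve-∀ ℚ-ring
  facetℚ-combination 3F lam = cancel (lam 1F) (lam 3F)
    where
    cancel : ∀ b d → 60ℚ * (b + d) - 60ℚ * b ≡ 60ℚ * d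
    cancel = solve-∀ ℚ-ring
  facetℚ-combination 4F lam = refl

  barycentric : ℚ → (Fin 4 → ℚ) → Fin 5 → ℚ
  barycentric T x i = facetℚ i T x * 1/ 60ℚ

  sumQ-barycentric : ∀ T x → sumQ (barycentric T x) ≡ T
  sumQ-barycentric T x = cancel T (x 0F) (x 1F) (x 2F) (x 3F)
    where
    cancel : ∀ T a b c d →
      (60ℚ * (T - a - b - d) + c) * 1/ 60ℚ + (c * 1/ 60ℚ + ((60ℚ * a - c) * 1/ 60ℚ +
        ((60ℚ * b - c) * 1/ 60ℚ + (60ℚ * d * 1/ 60ℚ + 0ℚ)))) ≡ T
    cancel = solve-∀ ℚ-ring

  combination-barycentric : ∀ T x k → combination (barycentric T x) k ≡ x k
  combination-barycentric T x 0F = cancel (x 0F) (x 2F)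
    where
    cancel : ∀ a c → c * 1/ 60ℚ + (60ℚ * a - c) * 1/ 60ℚ ≡ a
    cancel = solve-∀ ℚ-ring
  combination-barycentric T x 1F = cancel (x 1F) (x 2F)
    where
    cancel : ∀ b c → c * 1/ 60ℚ + (60ℚ * b - c) * 1/ 60ℚ ≡ b
    cancel = solve-∀ ℚ-ring
  combination-barycentric T x 2F = cancel (x 2F)
    where
    cancel : ∀ c → 60ℚ * (c * 1/ 60ℚ) ≡ c
    cancel = solve-∀ ℚ-ring
  combination-barycentric T x 3F = cancel (x 3F)
    where
    cancel : ∀ d → 60ℚ * d * 1/ 60ℚ ≡ d
    cancel = solve-∀ ℚ-ring

  inDilate-𝒜 : ∀ T x → InDilate 𝒜 T x ⇔ (∀ i → + 0 ℤ.≤ facet i T x)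
  inDilate-𝒜 T x = mk⇔ to from
    where
    x̂ : Fin 4 → ℚ
    x̂ = ℤ→ℚ ∘ lookup x
    to : InDilate 𝒜 T x → ∀ i → + 0 ℤ.≤ facet i T x
    to (lam , 0≤lam , Σlam≡T , Σlam·v≡x) i =
      ℤ→ℚ-cancel-≤ (subst (0ℚ ≤_) (sym facet≡60·lam) (*-nonNeg (ℕ→ℚ-nonNeg 60) (0≤lam i)))
      where
      facet≡60·lam : ℤ→ℚ (facet i T x) ≡ 60ℚ * lam i
      facet≡60·lam = begin
        ℤ→ℚ (facet i T x)                     ≡⟨ ℤ→ℚ-facet i T x ⟩
        facetℚ i (ℕ→ℚ T) x̂                    ≡⟨ facetℚ-cong i (sym Σlam≡T) (λ k →
                                                   trans (sym (Σlam·v≡x k)) (sumQ-vertex lam k)) ⟩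
        facetℚ i (sumQ lam) (combination lam) ≡⟨ facetℚ-combination i lam ⟩
        60ℚ * lam i                           ∎
    from : (∀ i → + 0 ℤ.≤ facet i T x) → InDilate 𝒜 T x
    from 0≤facet =
      barycentric (ℕ→ℚ T) x̂ ,
      (λ i → *-nonNeg (subst (0ℚ ≤_) (ℤ→ℚ-facet i T x) (ℤ→ℚ-mono-≤ (0≤facet i))) (1/ℕ→ℚ-nonNeg 60)) ,
      sumQ-barycentric (ℕ→ℚ T) x̂ ,
      λ k → trans (sumQ-vertex _ k) (combination-barycentric (ℕ→ℚ T) x̂ k)

  affIndep-vertex : AffIndep vertex
  affIndep-vertex c Σc≡0 Σc·v≡0 i = *-cancelˡ-≡0 60ℚ (begin
    60ℚ * c i                                ≡⟨ facetℚ-combination i c ⟨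
    facetℚ i (sumQ c) (combination c)        ≡⟨ facetℚ-cong i Σc≡0 (λ k → trans (sym (sumQ-vertex c k)) (Σc·v≡0 k)) ⟩
    facetℚ i 0ℚ (λ _ → 0ℚ)                   ≡⟨ facetℚ-origin i ⟩
    0ℚ                                       ∎)
    where
    facetℚ-origin : ∀ i → facetℚ i 0ℚ (λ _ → 0ℚ) ≡ 0ℚ
    facetℚ-origin 0F = refl
    facetℚ-origin 1F = refl
    facetℚ-origin 2F = refl
    facetℚ-origin 3F = refl
    facetℚ-origin 4F = refl

module _ where
  open import Data.Nat using (_+_; _*_; _^_; _≤_; _<_)
  open import Data.List using (_++_)

  -- Lattice points of T𝒜

  incrementHead : ∀ {m} → Vec ℕ (suc m) → Vec ℕ (suc m)
  incrementHead (h ∷ v) = suc h ∷ v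

  simplexPoints : ∀ m → ℕ → List (Vec ℕ m)
  simplexPoints zero    S       = [ [] ]
  simplexPoints (suc m) zero    = map (0 ∷_) (simplexPoints m zero)
  simplexPoints (suc m) (suc S) =
    map (0 ∷_) (simplexPoints m (suc S)) ++ map incrementHead (simplexPoints (suc m) S)

  ∈-simplexPoints⁻ : ∀ {m S v} → v ∈ simplexPoints m S → Vec.sum v ≤ S
  ∈-simplexPoints⁻ {zero}  {S}     {[]} _ = z≤n
  ∈-simplexPoints⁻ {suc m} {zero}  v∈ with ∈-map⁻ (0 ∷_) v∈
  ... | w , w∈ , refl = ∈-simplexPoints⁻ w∈
  ∈-simplexPoints⁻ {suc m} {suc S} v∈ with ∈-++⁻ (map (0 ∷_) (simplexPoints m (suc S))) v∈
  ... | inj₁ v∈₀ with ∈-map⁻ (0 ∷_) v∈₀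
  ...   | w , w∈ , refl = ∈-simplexPoints⁻ w∈
  ∈-simplexPoints⁻ {suc m} {suc S} v∈ | inj₂ v∈₊ with ∈-map⁻ incrementHead v∈₊
  ...   | h ∷ w , w∈ , refl = s≤s (∈-simplexPoints⁻ w∈)

  ∈-simplexPoints⁺ : ∀ {m S} v → Vec.sum v ≤ S → v ∈ simplexPoints m S
  ∈-simplexPoints⁺ {zero}              []            _         = here refl
  ∈-simplexPoints⁺ {suc m} {zero}      (zero ∷ w)    Σw≤0      = ∈-map⁺ (0 ∷_) (∈-simplexPoints⁺ w Σw≤0)
  ∈-simplexPoints⁺ {suc m} {suc S}     (zero ∷ w)    Σw≤S      =
    ∈-++⁺ˡ (∈-map⁺ (0 ∷_) (∈-simplexPoints⁺ w Σw≤S))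
  ∈-simplexPoints⁺ {suc m} {suc S}     (suc h ∷ w) (s≤s Σv≤S) =
    ∈-++⁺ʳ (map (0 ∷_) (simplexPoints m (suc S))) (∈-map⁺ incrementHead (∈-simplexPoints⁺ (h ∷ w) Σv≤S))

  simplexPoints-unique : ∀ m S → Unique (simplexPoints m S)
  simplexPoints-unique zero    S       = [] ∷ []
  simplexPoints-unique (suc m) zero    = UniqueP.map⁺ VecP.∷-injectiveʳ (simplexPoints-unique m zero)
  simplexPoints-unique (suc m) (suc S) = UniqueP.++⁺
    (UniqueP.map⁺ VecP.∷-injectiveʳ (simplexPoints-unique m (suc S)))
    (UniqueP.map⁺ incrementHead-injective (simplexPoints-unique (suc m) S))
    disjoint
    where
    incrementHead-injective : ∀ {v w : Vec ℕ (suc m)} → incrementHead v ≡ incrementHead w → v ≡ w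
    incrementHead-injective {_ ∷ _} {_ ∷ _} refl = refl
    disjoint : ∀ {v} → ¬ (v ∈ map (0 ∷_) (simplexPoints m (suc S)) × v ∈ map incrementHead (simplexPoints (suc m) S))
    disjoint (v∈₀ , v∈₊) with ∈-map⁻ (0 ∷_) v∈₀ | ∈-map⁻ incrementHead v∈₊
    ... | _ , _ , refl | _ ∷ _ , _ , ()

  simplexCount : ℕ → ℕ → ℕ
  simplexCount m S = length (simplexPoints m S)

  simplexCount-pascal : ∀ m S → simplexCount (suc m) (suc S) ≡ simplexCount m (suc S) + simplexCount (suc m) S
  simplexCount-pascal m S = trans (ListP.length-++ (map (0 ∷_) (simplexPoints m (suc S))))
    (cong₂ _+_ (ListP.length-map (0 ∷_) (simplexPoints m (suc S)))
               (ListP.length-map incrementHead (simplexPoints (suc m) S)))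

  simplexCount₁ : ∀ S → simplexCount 1 S ≡ S + 1
  simplexCount₁ zero    = refl
  simplexCount₁ (suc S) = trans (simplexCount-pascal 0 S) (cong suc (simplexCount₁ S))

  simplexCount₂ : ∀ S → 2 * simplexCount 2 S ≡ (S + 1) * (S + 2)
  simplexCount₂ zero    = refl
  simplexCount₂ (suc S) = begin
    2 * simplexCount 2 (suc S)                          ≡⟨ cong (2 *_) (simplexCount-pascal 1 S) ⟩
    2 * (simplexCount 1 (suc S) + simplexCount 2 S)     ≡⟨ ℕP.*-distribˡ-+ 2 (simplexCount 1 (suc S)) (simplexCount 2 S) ⟩
    2 * simplexCount 1 (suc S) + 2 * simplexCount 2 S   ≡⟨ cong₂ _+_ (cong (2 *_) (simplexCount₁ (suc S))) (simplexCount₂ S) ⟩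
    2 * (suc S + 1) + (S + 1) * (S + 2)                 ≡⟨ step S ⟩
    (suc S + 1) * (suc S + 2)                           ∎
    where
    open ≡-Reasoning
    step : ∀ S → 2 * (suc S + 1) + (S + 1) * (S + 2) ≡ (suc S + 1) * (suc S + 2)
    step = ℕSolver.solve-∀

  simplexCount₃ : ∀ S → 6 * simplexCount 3 S ≡ (S + 1) * (S + 2) * (S + 3)
  simplexCount₃ zero    = refl
  simplexCount₃ (suc S) = begin
    6 * simplexCount 3 (suc S)                          ≡⟨ cong (6 *_) (simplexCount-pascal 2 S) ⟩
    6 * (simplexCount 2 (suc S) + simplexCount 3 S)     ≡⟨ regroup (simplexCount 2 (suc S)) (simplexCount 3 S) ⟩
    3 * (2 * simplexCount 2 (suc S)) + 6 * simplexCount 3 S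
      ≡⟨ cong₂ _+_ (cong (3 *_) (simplexCount₂ (suc S))) (simplexCount₃ S) ⟩
    3 * ((suc S + 1) * (suc S + 2)) + (S + 1) * (S + 2) * (S + 3) ≡⟨ step S ⟩
    (suc S + 1) * (suc S + 2) * (suc S + 3)             ∎
    where
    open ≡-Reasoning
    regroup : ∀ x y → 6 * (x + y) ≡ 3 * (2 * x) + 6 * y
    regroup = ℕSolver.solve-∀
    step : ∀ S → 3 * ((suc S + 1) * (suc S + 2)) + (S + 1) * (S + 2) * (S + 3) ≡ (suc S + 1) * (suc S + 2) * (suc S + 3)
    step = ℕSolver.solve-∀

  simplexCount₄ : ∀ S → 24 * simplexCount 4 S ≡ (S + 1) * (S + 2) * (S + 3) * (S + 4)
  simplexCount₄ zero    = refl
  simplexCount₄ (suc S) = begin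
    24 * simplexCount 4 (suc S)                         ≡⟨ cong (24 *_) (simplexCount-pascal 3 S) ⟩
    24 * (simplexCount 3 (suc S) + simplexCount 4 S)    ≡⟨ regroup (simplexCount 3 (suc S)) (simplexCount 4 S) ⟩
    4 * (6 * simplexCount 3 (suc S)) + 24 * simplexCount 4 S
      ≡⟨ cong₂ _+_ (cong (4 *_) (simplexCount₃ (suc S))) (simplexCount₄ S) ⟩
    4 * ((suc S + 1) * (suc S + 2) * (suc S + 3)) + (S + 1) * (S + 2) * (S + 3) * (S + 4) ≡⟨ step S ⟩
    (suc S + 1) * (suc S + 2) * (suc S + 3) * (suc S + 4) ∎
    where
    open ≡-Reasoning
    regroup : ∀ x y → 24 * (x + y) ≡ 4 * (6 * x) + 24 * y
    regroup = ℕSolver.solve-∀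
    step : ∀ S → 4 * ((suc S + 1) * (suc S + 2) * (suc S + 3)) + (S + 1) * (S + 2) * (S + 3) * (S + 4)
               ≡ (suc S + 1) * (suc S + 2) * (suc S + 3) * (suc S + 4)
    step = ℕSolver.solve-∀

  quotRem-injective : ∀ n .{{_ : ℕ.NonZero n}} {r r′ a a′} → r < n → r′ < n →
                      r + a * n ≡ r′ + a′ * n → r ≡ r′ × a ≡ a′
  quotRem-injective n {r} {r′} {a} {a′} r<n r′<n eq = r≡r′ , a≡a′
    where
    remainder : ∀ {r} a → r < n → (r + a * n) % n ≡ r
    remainder {r} a r<n = trans ([m+kn]%n≡m%n r a n) (m<n⇒m%n≡m r<n)
    r≡r′ : r ≡ r′
    r≡r′ = trans (sym (remainder a r<n)) (trans (cong (_% n) eq) (remainder a′ r′<n))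
    a≡a′ : a ≡ a′
    a≡a′ = ℕP.*-cancelʳ-≡ a a′ n (ℕP.+-cancelˡ-≡ r _ _ (trans eq (cong (λ s → s + a′ * n) (sym r≡r′))))

  -- Write x₃ = 60a + r with 0 ≤ r < 60. For r = 0 the lattice points of T𝒜 are the points
  -- shape 0 zero (a ∷ b ∷ c ∷ e ∷ []) with a + b + c + e ≤ T; for r > 0 the facets 60x₁ ≥ x₃
  -- and 60x₂ ≥ x₃ force x₁, x₂ > a, hence the shift by 1 and the budget T − 2.
  shape : ℕ → Fin 60 → Vec ℕ 4 → Vec ℕ 4
  shape lift r (a ∷ b ∷ c ∷ e ∷ []) = lift + (a + b) ∷ lift + (a + c) ∷ toℕ r + a * 60 ∷ e ∷ []

  shape-residue : ∀ {l l′ r r′ v w} → shape l r v ≡ shape l′ r′ w → r ≡ r′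
  shape-residue {r = r} {r′} {a ∷ _ ∷ _ ∷ _ ∷ []} {a′ ∷ _ ∷ _ ∷ _ ∷ []} eq =
    FinP.toℕ-injective (proj₁ (quotRem-injective 60 {a = a} {a′} (FinP.toℕ<n r) (FinP.toℕ<n r′)
      (cong (λ p → Vec.lookup p 2F) eq)))

  shape-injective : ∀ {l r v w} → shape l r v ≡ shape l r w → v ≡ w
  shape-injective {l} {r} {a ∷ b ∷ c ∷ e ∷ []} {a′ ∷ b′ ∷ c′ ∷ e′ ∷ []} eq
    with ℕP.*-cancelʳ-≡ a a′ 60 (ℕP.+-cancelˡ-≡ (toℕ r) _ _ (cong (λ p → Vec.lookup p 2F) eq))
  ... | refl
    with ℕP.+-cancelˡ-≡ a _ _ (ℕP.+-cancelˡ-≡ l _ _ (cong (λ p → Vec.lookup p 0F) eq))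
       | ℕP.+-cancelˡ-≡ a _ _ (ℕP.+-cancelˡ-≡ l _ _ (cong (λ p → Vec.lookup p 1F) eq))
       | cong (λ p → Vec.lookup p 3F) eq
  ... | refl | refl | refl = refl

  shiftedPoints : ℕ → List (Vec ℕ 4)
  shiftedPoints (suc (suc T)) = cartesianProductWith (λ σ → shape 1 (Fin.suc σ)) (allFin 59) (simplexPoints 4 T)
  shiftedPoints _             = List.[]

  admissiblePoints : ℕ → List (Vec ℕ 4)
  admissiblePoints T = map (shape 0 Fin.zero) (simplexPoints 4 T) ++ shiftedPoints T

  Admissible : ℕ → Vec ℕ 4 → Set
  Admissible T (p₁ ∷ p₂ ∷ p₃ ∷ p₄ ∷ []) =
    p₃ ≤ 60 * p₁ × p₃ ≤ 60 * p₂ × 60 * p₁ + 60 * p₂ + 60 * p₄ ≤ 60 * T + p₃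

  module _ where
    open ℕP.≤-Reasoning

    admissible-unshifted : ∀ {T} v → Vec.sum v ≤ T → Admissible T (shape 0 Fin.zero v)
    admissible-unshifted {T} (a ∷ b ∷ c ∷ e ∷ []) Σv≤T = below b , below c , (begin
      60 * (a + b) + 60 * (a + c) + 60 * e       ≡⟨ regroup a b c e ⟩
      60 * (a + (b + (c + (e + 0)))) + a * 60    ≤⟨ ℕP.+-monoˡ-≤ (a * 60) (ℕP.*-monoʳ-≤ 60 Σv≤T) ⟩
      60 * T + a * 60                            ∎)
      where
      below : ∀ b → a * 60 ≤ 60 * (a + b)
      below b = begin
        a * 60              ≤⟨ ℕP.m≤m+n (a * 60) (60 * b) ⟩
        a * 60 + 60 * b     ≡⟨ distrib a b ⟩
        60 * (a + b)        ∎
        where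
        distrib : ∀ a b → a * 60 + 60 * b ≡ 60 * (a + b)
        distrib = ℕSolver.solve-∀
      regroup : ∀ a b c e → 60 * (a + b) + 60 * (a + c) + 60 * e ≡ 60 * (a + (b + (c + (e + 0)))) + a * 60
      regroup = ℕSolver.solve-∀

    admissible-shifted : ∀ {T} σ v → Vec.sum v ≤ T → Admissible (2 + T) (shape 1 (Fin.suc σ) v)
    admissible-shifted {T} σ (a ∷ b ∷ c ∷ e ∷ []) Σv≤T = below b , below c , (begin
      60 * (1 + (a + b)) + 60 * (1 + (a + c)) + 60 * e   ≡⟨ regroup a b c e ⟩
      60 * (2 + (a + (b + (c + (e + 0))))) + a * 60      ≤⟨ ℕP.+-monoˡ-≤ (a * 60) (ℕP.*-monoʳ-≤ 60 (s≤s (s≤s Σv≤T))) ⟩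
      60 * (2 + T) + a * 60                              ≤⟨ ℕP.+-monoʳ-≤ (60 * (2 + T)) (ℕP.m≤n+m (a * 60) r) ⟩
      60 * (2 + T) + (r + a * 60)                        ∎)
      where
      r : ℕ
      r = suc (toℕ σ)
      below : ∀ b → r + a * 60 ≤ 60 * (1 + (a + b))
      below b = begin
        r + a * 60               ≤⟨ ℕP.+-monoˡ-≤ (a * 60) (ℕP.<⇒≤ (s≤s (FinP.toℕ<n σ))) ⟩
        60 + a * 60              ≤⟨ ℕP.m≤m+n (60 + a * 60) (60 * b) ⟩
        60 + a * 60 + 60 * b     ≡⟨ distrib a b ⟩
        60 * (1 + (a + b))       ∎
        where
        distrib : ∀ a b → 60 + a * 60 + 60 * b ≡ 60 * (1 + (a + b))
        distrib = ℕSolver.solve-∀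
      regroup : ∀ a b c e → 60 * (1 + (a + b)) + 60 * (1 + (a + c)) + 60 * e ≡ 60 * (2 + (a + (b + (c + (e + 0))))) + a * 60
      regroup = ℕSolver.solve-∀

  ∈-admissiblePoints⁻ : ∀ {T p} → p ∈ admissiblePoints T → Admissible T p
  ∈-admissiblePoints⁻ {T} p∈ with ∈-++⁻ (map (shape 0 Fin.zero) (simplexPoints 4 T)) p∈
  ... | inj₁ p∈₀ with ∈-map⁻ (shape 0 Fin.zero) p∈₀
  ...   | v , v∈ , refl = admissible-unshifted v (∈-simplexPoints⁻ v∈)
  ∈-admissiblePoints⁻ {suc (suc T)} p∈ | inj₂ p∈₊
    with ∈-cartesianProductWith⁻ (λ σ → shape 1 (Fin.suc σ)) (allFin 59) (simplexPoints 4 T) p∈₊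
  ... | σ , v , _ , v∈ , refl = admissible-shifted σ v (∈-simplexPoints⁻ v∈)

  admissiblePoints-unique : ∀ T → Unique (admissiblePoints T)
  admissiblePoints-unique T =
    UniqueP.++⁺ (UniqueP.map⁺ shape-injective (simplexPoints-unique 4 T)) (shifted-unique T) disjoint
    where
    shifted-unique : ∀ T → Unique (shiftedPoints T)
    shifted-unique zero          = []
    shifted-unique (suc zero)    = []
    shifted-unique (suc (suc T)) = UniqueP.cartesianProductWith⁺ _ injective (UniqueP.allFin⁺ 59) (simplexPoints-unique 4 T)
      where
      injective : ∀ {σ σ′ v w} → shape 1 (Fin.suc σ) v ≡ shape 1 (Fin.suc σ′) w → σ ≡ σ′ × v ≡ w
      injective eq with shape-residue eq
      ... | refl = refl , shape-injective eq
    disjoint : ∀ {p} → ¬ (p ∈ map (shape 0 Fin.zero) (simplexPoints 4 T) × p ∈ shiftedPoints T)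
    disjoint {p} (p∈₀ , p∈₊) with ∈-map⁻ (shape 0 Fin.zero) p∈₀
    ... | v , _ , refl = unshifted∉shifted T p∈₊
      where
      unshifted∉shifted : ∀ T → ¬ (shape 0 Fin.zero v ∈ shiftedPoints T)
      unshifted∉shifted (suc (suc T)) p∈₊
        with ∈-cartesianProductWith⁻ (λ σ → shape 1 (Fin.suc σ)) (allFin 59) (simplexPoints 4 T) p∈₊
      ... | σ , w , _ , _ , eq with shape-residue eq
      ... | ()

  private
    module _ where
      open ℕP.≤-Reasoning

      quotient≤ : ∀ {a p} → a * 60 ≤ 60 * p → a ≤ p
      quotient≤ {a} {p} a·60≤60·p = ℕP.*-cancelʳ-≤ a p 60 (subst (a * 60 ≤_) (ℕP.*-comm 60 p) a·60≤60·p)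

      quotient< : ∀ {r a p} → suc r + a * 60 ≤ 60 * p → a ℕ.< p
      quotient< {r} {a} {p} r+a·60≤60·p = ℕP.*-cancelʳ-< 60 a p (begin-strict
        a * 60          <⟨ s≤s (ℕP.m≤n+m (a * 60) r) ⟩
        suc r + a * 60  ≤⟨ r+a·60≤60·p ⟩
        60 * p          ≡⟨ ℕP.*-comm 60 p ⟩
        p * 60          ∎)

      budget-unshifted : ∀ {T} a b c e → 60 * (a + b) + 60 * (a + c) + 60 * e ≤ 60 * T + a * 60 →
                         a + (b + (c + (e + 0))) ≤ T
      budget-unshifted {T} a b c e h = ℕP.*-cancelˡ-≤ 60 (ℕP.+-cancelʳ-≤ (a * 60) _ _ (begin
        60 * (a + (b + (c + (e + 0)))) + a * 60   ≡⟨ regroup a b c e ⟨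
        60 * (a + b) + 60 * (a + c) + 60 * e      ≤⟨ h ⟩
        60 * T + a * 60                           ∎))
        where
        regroup : ∀ a b c e → 60 * (a + b) + 60 * (a + c) + 60 * e ≡ 60 * (a + (b + (c + (e + 0)))) + a * 60
        regroup = ℕSolver.solve-∀

      budget-shifted : ∀ {T r} a b c e → r < 60 →
                       60 * suc (a + b) + 60 * suc (a + c) + 60 * e ≤ 60 * T + (r + a * 60) →
                       2 + (a + (b + (c + (e + 0)))) ≤ T
      budget-shifted {T} {r} a b c e r<60 h = ℕ.s≤s⁻¹ (ℕP.*-cancelˡ-< 60 _ _ (ℕP.+-cancelʳ-< (a * 60) _ _ (begin-strict
        60 * (2 + (a + (b + (c + (e + 0))))) + a * 60   ≡⟨ regroup a b c e ⟨
        60 * suc (a + b) + 60 * suc (a + c) + 60 * e    ≤⟨ h ⟩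
        60 * T + (r + a * 60)                           <⟨ ℕP.+-monoʳ-< (60 * T) (ℕP.+-monoˡ-< (a * 60) r<60) ⟩
        60 * T + (60 + a * 60)                          ≡⟨ shift T a ⟩
        60 * suc T + a * 60                             ∎)))
        where
        regroup : ∀ a b c e → 60 * suc (a + b) + 60 * suc (a + c) + 60 * e ≡ 60 * (2 + (a + (b + (c + (e + 0))))) + a * 60
        regroup = ℕSolver.solve-∀
        shift : ∀ T a → 60 * T + (60 + a * 60) ≡ 60 * suc T + a * 60
        shift = ℕSolver.solve-∀

  unshifted-complete : ∀ {T} a p₁ p₂ p₄ → Admissible T (p₁ ∷ p₂ ∷ a * 60 ∷ p₄ ∷ []) →
                       (p₁ ∷ p₂ ∷ a * 60 ∷ p₄ ∷ []) ∈ admissiblePoints T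
  unshifted-complete {T} a p₁ p₂ p₄ (h₁ , h₂ , h₀) =
    subst₂ (λ x y → (x ∷ y ∷ a * 60 ∷ p₄ ∷ []) ∈ admissiblePoints T) a+b≡p₁ a+c≡p₂
      (∈-++⁺ˡ (∈-map⁺ (shape 0 Fin.zero) (∈-simplexPoints⁺ (a ∷ b ∷ c ∷ p₄ ∷ []) S≤T)))
    where
    b c : ℕ
    b = p₁ ℕ.∸ a
    c = p₂ ℕ.∸ a
    a+b≡p₁ : a + b ≡ p₁
    a+b≡p₁ = ℕP.m+[n∸m]≡n (quotient≤ {a} {p₁} h₁)
    a+c≡p₂ : a + c ≡ p₂
    a+c≡p₂ = ℕP.m+[n∸m]≡n (quotient≤ {a} {p₂} h₂)
    S≤T : a + (b + (c + (p₄ + 0))) ≤ T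
    S≤T = budget-unshifted a b c p₄
      (subst₂ (λ x y → 60 * x + 60 * y + 60 * p₄ ≤ 60 * T + a * 60) (sym a+b≡p₁) (sym a+c≡p₂) h₀)

  shifted-complete : ∀ {T} σ a p₁ p₂ p₄ → Admissible T (p₁ ∷ p₂ ∷ suc (toℕ σ) + a * 60 ∷ p₄ ∷ []) →
                     (p₁ ∷ p₂ ∷ suc (toℕ σ) + a * 60 ∷ p₄ ∷ []) ∈ admissiblePoints T
  shifted-complete {T} σ a p₁ p₂ p₄ (h₁ , h₂ , h₀) =
    subst (λ T → (p₁ ∷ p₂ ∷ suc (toℕ σ) + a * 60 ∷ p₄ ∷ []) ∈ admissiblePoints T) 2+S+k≡T
      (subst₂ (λ x y → (x ∷ y ∷ suc (toℕ σ) + a * 60 ∷ p₄ ∷ []) ∈ admissiblePoints (2 + S + k)) 1+a+b≡p₁ 1+a+c≡p₂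
        (∈-++⁺ʳ (map (shape 0 Fin.zero) (simplexPoints 4 (2 + S + k)))
          (∈-cartesianProductWith⁺ (λ σ → shape 1 (Fin.suc σ)) (∈-allFin σ)
            (∈-simplexPoints⁺ (a ∷ b ∷ c ∷ p₄ ∷ []) (ℕP.m≤m+n S k)))))
    where
    b c S k : ℕ
    b = p₁ ℕ.∸ suc a
    c = p₂ ℕ.∸ suc a
    S = a + (b + (c + (p₄ + 0)))
    1+a+b≡p₁ : suc (a + b) ≡ p₁
    1+a+b≡p₁ = ℕP.m+[n∸m]≡n (quotient< {toℕ σ} {a} {p₁} h₁)
    1+a+c≡p₂ : suc (a + c) ≡ p₂
    1+a+c≡p₂ = ℕP.m+[n∸m]≡n (quotient< {toℕ σ} {a} {p₂} h₂)
    2+S≤T : 2 + S ≤ T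
    2+S≤T = budget-shifted a b c p₄ (s≤s (FinP.toℕ<n σ))
      (subst₂ (λ x y → 60 * x + 60 * y + 60 * p₄ ≤ 60 * T + (suc (toℕ σ) + a * 60)) (sym 1+a+b≡p₁) (sym 1+a+c≡p₂) h₀)
    k = T ℕ.∸ (2 + S)
    2+S+k≡T : 2 + S + k ≡ T
    2+S+k≡T = ℕP.m+[n∸m]≡n 2+S≤T

  ∈-admissiblePoints⁺ : ∀ {T} p → Admissible T p → p ∈ admissiblePoints T
  ∈-admissiblePoints⁺ {T} (p₁ ∷ p₂ ∷ p₃ ∷ p₄ ∷ []) adm with p₃ divMod 60
  ... | result a Fin.zero    refl = unshifted-complete {T} a p₁ p₂ p₄ adm
  ... | result a (Fin.suc σ) refl = shifted-complete {T} σ a p₁ p₂ p₄ adm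

  toℤ : Vec ℕ 4 → Point 4
  toℤ = Vec.map (λ n → + n)

  toℤ-injective : ∀ {p q} → toℤ p ≡ toℤ q → p ≡ q
  toℤ-injective {_ ∷ _ ∷ _ ∷ _ ∷ []} {_ ∷ _ ∷ _ ∷ _ ∷ []} eq = cong (Vec.map ℤ.∣_∣) eq

  private
    +-difference : ∀ {m n} → + 0 ℤ.≤ + m ℤ.- + n → n ≤ m
    +-difference 0≤m-n = ℤP.drop‿+≤+ (ℤP.0≤i-j⇒j≤i 0≤m-n)

    +-difference⁻ : ∀ {m n} → n ≤ m → + 0 ℤ.≤ + m ℤ.- + n
    +-difference⁻ n≤m = ℤP.i≤j⇒0≤j-i (ℤ.+≤+ n≤m)

    60·_ : ∀ n → + 60 ℤ.* + n ≡ + (60 * n)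
    60· n = sym (ℤP.pos-* 60 n)

    natural : ∀ z → + 0 ℤ.≤ z → Σ ℕ λ n → z ≡ + n
    natural (+ n) _ = n , refl

    natural-60· : ∀ z → + 0 ℤ.≤ + 60 ℤ.* z → Σ ℕ λ n → z ≡ + n
    natural-60· (+ n)    _  = n , refl
    natural-60· -[1+ k ] ()

  facet₀-toℤ : ∀ T p₁ p₂ p₃ p₄ → facet 0F T (toℤ (p₁ ∷ p₂ ∷ p₃ ∷ p₄ ∷ [])) ≡
               + (60 * T + p₃) ℤ.- + (60 * p₁ + 60 * p₂ + 60 * p₄)
  facet₀-toℤ T p₁ p₂ p₃ p₄ = trans (regroup (+ T) (+ p₁) (+ p₂) (+ p₃) (+ p₄)) (cong₂ ℤ._-_
    (cong (ℤ._+ + p₃) (60· T))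
    (cong₂ ℤ._+_ (cong₂ ℤ._+_ (60· p₁) (60· p₂)) (60· p₄)))
    where
    regroup : ∀ t a b c d → + 60 ℤ.* (t ℤ.- a ℤ.- b ℤ.- d) ℤ.+ c ≡
                            (+ 60 ℤ.* t ℤ.+ c) ℤ.- (+ 60 ℤ.* a ℤ.+ + 60 ℤ.* b ℤ.+ + 60 ℤ.* d)
    regroup = ℤSolver.solve-∀

  admissible⇒facets : ∀ {T} p → Admissible T p → ∀ i → + 0 ℤ.≤ facet i T (toℤ p)
  admissible⇒facets {T} (p₁ ∷ p₂ ∷ p₃ ∷ p₄ ∷ []) (h₁ , h₂ , h₀) = λ
    { 0F → subst (+ 0 ℤ.≤_) (sym (facet₀-toℤ T p₁ p₂ p₃ p₄)) (+-difference⁻ h₀)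
    ; 1F → ℤ.+≤+ z≤n
    ; 2F → subst (λ z → + 0 ℤ.≤ z ℤ.- + p₃) (sym (60· p₁)) (+-difference⁻ h₁)
    ; 3F → subst (λ z → + 0 ℤ.≤ z ℤ.- + p₃) (sym (60· p₂)) (+-difference⁻ h₂)
    ; 4F → subst (+ 0 ℤ.≤_) (sym (60· p₄)) (ℤ.+≤+ z≤n)
    }

  facets⇒admissible : ∀ {T} x → (∀ i → + 0 ℤ.≤ facet i T x) → Σ (Vec ℕ 4) λ p → x ≡ toℤ p × Admissible T p
  facets⇒admissible {T} (x₁ ∷ x₂ ∷ x₃ ∷ x₄ ∷ []) h
    with natural x₃ (h 1F)
  ... | p₃ , refl
    with natural-60· x₁ (ℤP.≤-trans (h 1F) (ℤP.0≤i-j⇒j≤i (h 2F)))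
       | natural-60· x₂ (ℤP.≤-trans (h 1F) (ℤP.0≤i-j⇒j≤i (h 3F)))
       | natural-60· x₄ (h 4F)
  ... | p₁ , refl | p₂ , refl | p₄ , refl =
    (p₁ ∷ p₂ ∷ p₃ ∷ p₄ ∷ []) , refl ,
    +-difference (subst (λ z → + 0 ℤ.≤ z ℤ.- + p₃) (60· p₁) (h 2F)) ,
    +-difference (subst (λ z → + 0 ℤ.≤ z ℤ.- + p₃) (60· p₂) (h 3F)) ,
    +-difference (subst (+ 0 ℤ.≤_) (facet₀-toℤ T p₁ p₂ p₃ p₄) (h 0F))

  latticeCount-𝒜 : ∀ T → LatticeCount 𝒜 T (ℕ→ℚ (length (admissiblePoints T)))
  latticeCount-𝒜 T =
    map toℤ (admissiblePoints T) ,
    UniqueP.map⁺ toℤ-injective (admissiblePoints-unique T) ,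
    (λ x → to x , from x) ,
    cong ℕ→ℚ (ListP.length-map toℤ (admissiblePoints T))
    where
    to : ∀ x → x ∈ map toℤ (admissiblePoints T) → InDilate 𝒜 T x
    to x x∈ with ∈-map⁻ toℤ x∈
    ... | p , p∈ , refl = Equivalence.from (inDilate-𝒜 T (toℤ p)) (admissible⇒facets p (∈-admissiblePoints⁻ p∈))
    from : ∀ x → InDilate 𝒜 T x → x ∈ map toℤ (admissiblePoints T)
    from x x∈T𝒜 with facets⇒admissible x (Equivalence.to (inDilate-𝒜 T x) x∈T𝒜)
    ... | p , refl , adm = ∈-map⁺ toℤ (∈-admissiblePoints⁺ p adm)

  admissibleCount : ∀ T → 1 ≤ T → 24 * length (admissiblePoints T) + (68 * T + 24 * T ^ 2) ≡ 24 + 128 * T ^ 3 + 60 * T ^ 4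
  admissibleCount 1 _ = refl
  admissibleCount (suc (suc T)) _ = begin
    24 * length (admissiblePoints (2 + T)) + (68 * (2 + T) + 24 * (2 + T) ^ 2)
      ≡⟨ cong (λ L → 24 * L + (68 * (2 + T) + 24 * (2 + T) ^ 2)) |admissiblePoints| ⟩
    24 * (simplexCount 4 (2 + T) + 59 * simplexCount 4 T) + (68 * (2 + T) + 24 * (2 + T) ^ 2)
      ≡⟨ regroup (simplexCount 4 (2 + T)) (simplexCount 4 T) T ⟩
    24 * simplexCount 4 (2 + T) + 59 * (24 * simplexCount 4 T) + (68 * (2 + T) + 24 * (2 + T) ^ 2)
      ≡⟨ cong₂ (λ a b → a + 59 * b + (68 * (2 + T) + 24 * (2 + T) ^ 2)) (simplexCount₄ (2 + T)) (simplexCount₄ T) ⟩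
    (2 + T + 1) * (2 + T + 2) * (2 + T + 3) * (2 + T + 4) + 59 * ((T + 1) * (T + 2) * (T + 3) * (T + 4)) + (68 * (2 + T) + 24 * (2 + T) ^ 2)
      ≡⟨ quartic T ⟩
    24 + 128 * (2 + T) ^ 3 + 60 * (2 + T) ^ 4 ∎
    where
    open ≡-Reasoning
    |admissiblePoints| : length (admissiblePoints (2 + T)) ≡ simplexCount 4 (2 + T) + 59 * simplexCount 4 T
    |admissiblePoints| = trans (ListP.length-++ (map (shape 0 Fin.zero) (simplexPoints 4 (2 + T))))
      (cong₂ _+_ (ListP.length-map (shape 0 Fin.zero) (simplexPoints 4 (2 + T)))
                 (length-cartesianProductWith (λ σ → shape 1 (Fin.suc σ)) (allFin 59) (simplexPoints 4 T)))
    regroup : ∀ a b T → 24 * (a + 59 * b) + (68 * (2 + T) + 24 * ((2 + T) * ((2 + T) * 1))) ≡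
                        24 * a + 59 * (24 * b) + (68 * (2 + T) + 24 * ((2 + T) * ((2 + T) * 1)))
    regroup = ℕSolver.solve-∀
    quartic : ∀ T → (2 + T + 1) * (2 + T + 2) * (2 + T + 3) * (2 + T + 4) + 59 * ((T + 1) * (T + 2) * (T + 3) * (T + 4)) + (68 * (2 + T) + 24 * ((2 + T) * ((2 + T) * 1)))
                    ≡ 24 + 128 * ((2 + T) * ((2 + T) * ((2 + T) * 1))) + 60 * ((2 + T) * ((2 + T) * ((2 + T) * ((2 + T) * 1))))
    quartic = ℕSolver.solve-∀

  -- Ehrhart coefficients of n𝒜 × [0,1]ᵏ

  C-mono : ∀ k i → k C i ≤ suc k C i
  C-mono k zero    = ℕP.≤-refl
  C-mono k (suc i) = subst (k C suc i ≤_) (nCk+nC[k+1]≡[n+1]C[k+1] k i) (ℕP.m≤n+m (k C suc i) (k C i))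

  C-suc≤ : ∀ k i → k C suc i ≤ k * (k C i)
  C-suc≤ zero    i = z≤n
  C-suc≤ (suc k) i = begin
    suc k C suc i          ≡⟨ nCk+nC[k+1]≡[n+1]C[k+1] k i ⟨
    k C i + k C suc i      ≤⟨ ℕP.+-monoʳ-≤ (k C i) (C-suc≤ k i) ⟩
    k C i + k * (k C i)    ≡⟨⟩
    suc k * (k C i)        ≤⟨ ℕP.*-monoʳ-≤ (suc k) (C-mono k i) ⟩
    suc k * (suc k C i)    ∎
    where open ℕP.≤-Reasoning

  C-pos : ∀ {k i} → i ≤ k → 1 ≤ k C i
  C-pos {k}     {zero}  _         = ℕP.≤-refl
  C-pos {suc k} {suc i} (s≤s i≤k) =
    ℕP.≤-trans (C-pos i≤k) (subst (k C i ≤_) (nCk+nC[k+1]≡[n+1]C[k+1] k i) (ℕP.m≤m+n (k C i) (k C suc i)))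

  shiftedBinomial : ℕ → ℕ → ℕ → ℕ
  shiftedBinomial k zero    j       = k C j
  shiftedBinomial k (suc i) zero    = 0
  shiftedBinomial k (suc i) (suc j) = shiftedBinomial k i j

  shiftedBinomial-zero : ∀ k i → shiftedBinomial (suc k) i 0 ≡ shiftedBinomial k i 0
  shiftedBinomial-zero k zero    = refl
  shiftedBinomial-zero k (suc i) = refl

  shiftedBinomial-pascal : ∀ k i j →
    shiftedBinomial (suc k) i (suc j) ≡ shiftedBinomial k i (suc j) + shiftedBinomial k i j
  shiftedBinomial-pascal k zero    j       =
    trans (sym (nCk+nC[k+1]≡[n+1]C[k+1] k j)) (ℕP.+-comm (k C j) (k C suc j))
  shiftedBinomial-pascal k (suc i) zero    =
    trans (shiftedBinomial-zero k i) (sym (ℕP.+-identityʳ (shiftedBinomial k i 0)))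
  shiftedBinomial-pascal k (suc i) (suc j) = shiftedBinomial-pascal k i j

  shiftedBinomial-vanish : ∀ k i j → k + i < j → shiftedBinomial k i j ≡ 0
  shiftedBinomial-vanish k zero    j       k+0<j = k>n⇒nCk≡0 (subst (_< j) (ℕP.+-identityʳ k) k+0<j)
  shiftedBinomial-vanish k (suc i) (suc j) k+1+i<1+j =
    shiftedBinomial-vanish k i j (ℕ.s≤s⁻¹ (subst (_< suc j) (ℕP.+-suc k i) k+1+i<1+j))


  polyEvalℕ : ℕ → (ℕ → ℕ) → ℕ → ℕ
  polyEvalℕ zero    c t = c 0
  polyEvalℕ (suc d) c t = polyEvalℕ d c t + c (suc d) * t ^ suc d


  -- 24 times the coefficient of tʲ in i(n𝒜 × [0,1]ᵏ, t) is positivePart n k j − negativePart n k j,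
  -- shiftedBinomial k i j being the coefficient of tʲ in tⁱ(1 + t)ᵏ.
  positivePart negativePart : ℕ → ℕ → ℕ → ℕ
  positivePart n k j = 24 * shiftedBinomial k 0 j + 128 * n ^ 3 * shiftedBinomial k 3 j + 60 * n ^ 4 * shiftedBinomial k 4 j
  negativePart n k j = 68 * n * shiftedBinomial k 1 j + 24 * n ^ 2 * shiftedBinomial k 2 j


  positivePart-suc₀ : ∀ n k → positivePart n (suc k) 0 ≡ positivePart n k 0
  positivePart-suc₀ n k = refl

  negativePart-suc₀ : ∀ n k → negativePart n (suc k) 0 ≡ negativePart n k 0
  negativePart-suc₀ n k = refl

  positivePart-pascal : ∀ n k j → positivePart n (suc k) (suc j) ≡ positivePart n k (suc j) + positivePart n k j
  positivePart-pascal n k j = begin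
    24 * B (suc k) 0 (suc j) + 128 * n ^ 3 * B (suc k) 3 (suc j) + 60 * n ^ 4 * B (suc k) 4 (suc j)
      ≡⟨ cong₂ _+_ (cong₂ _+_ (cong (24 *_) (pascal 0)) (cong (128 * n ^ 3 *_) (pascal 3)))
                   (cong (60 * n ^ 4 *_) (pascal 4)) ⟩
    24 * (B k 0 (suc j) + B k 0 j) + 128 * n ^ 3 * (B k 3 (suc j) + B k 3 j) + 60 * n ^ 4 * (B k 4 (suc j) + B k 4 j)
      ≡⟨ regroup (n ^ 3) (n ^ 4) (B k 0 (suc j)) (B k 0 j) (B k 3 (suc j)) (B k 3 j) (B k 4 (suc j)) (B k 4 j) ⟩
    positivePart n k (suc j) + positivePart n k j ∎
    where
    open ≡-Reasoning
    B : ℕ → ℕ → ℕ → ℕ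
    B = shiftedBinomial
    pascal : ∀ i → B (suc k) i (suc j) ≡ B k i (suc j) + B k i j
    pascal i = shiftedBinomial-pascal k i j
    regroup : ∀ x y a a′ b b′ c c′ → 24 * (a + a′) + 128 * x * (b + b′) + 60 * y * (c + c′) ≡
                                     (24 * a + 128 * x * b + 60 * y * c) + (24 * a′ + 128 * x * b′ + 60 * y * c′)
    regroup = ℕSolver.solve-∀

  negativePart-pascal : ∀ n k j → negativePart n (suc k) (suc j) ≡ negativePart n k (suc j) + negativePart n k j
  negativePart-pascal n k j = begin
    68 * n * B (suc k) 1 (suc j) + 24 * n ^ 2 * B (suc k) 2 (suc j)
      ≡⟨ cong₂ _+_ (cong (68 * n *_) (pascal 1)) (cong (24 * n ^ 2 *_) (pascal 2)) ⟩
    68 * n * (B k 1 (suc j) + B k 1 j) + 24 * n ^ 2 * (B k 2 (suc j) + B k 2 j)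
      ≡⟨ regroup n (n ^ 2) (B k 1 (suc j)) (B k 1 j) (B k 2 (suc j)) (B k 2 j) ⟩
    negativePart n k (suc j) + negativePart n k j ∎
    where
    open ≡-Reasoning
    B : ℕ → ℕ → ℕ → ℕ
    B = shiftedBinomial
    pascal : ∀ i → B (suc k) i (suc j) ≡ B k i (suc j) + B k i j
    pascal i = shiftedBinomial-pascal k i j
    regroup : ∀ n x a a′ b b′ → 68 * n * (a + a′) + 24 * x * (b + b′) ≡ (68 * n * a + 24 * x * b) + (68 * n * a′ + 24 * x * b′)
    regroup = ℕSolver.solve-∀


  shiftedBinomial-beyondDegree : ∀ k i → i ≤ 4 → shiftedBinomial k i (suc (4 + k)) ≡ 0
  shiftedBinomial-beyondDegree k i i≤4 =
    shiftedBinomial-vanish k i (suc (4 + k)) (s≤s (subst (k + i ≤_) (ℕP.+-comm k 4) (ℕP.+-monoʳ-≤ k i≤4)))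

  positivePart-beyondDegree : ∀ n k → positivePart n k (suc (4 + k)) ≡ 0
  positivePart-beyondDegree n k
    rewrite shiftedBinomial-beyondDegree k 0 z≤n
          | shiftedBinomial-beyondDegree k 3 (s≤s (s≤s (s≤s z≤n)))
          | shiftedBinomial-beyondDegree k 4 ℕP.≤-refl
    = zeros (n ^ 3) (n ^ 4)
    where
    zeros : ∀ x y → 24 * 0 + 128 * x * 0 + 60 * y * 0 ≡ 0
    zeros = ℕSolver.solve-∀

  negativePart-beyondDegree : ∀ n k → negativePart n k (suc (4 + k)) ≡ 0
  negativePart-beyondDegree n k
    rewrite shiftedBinomial-beyondDegree k 1 (s≤s z≤n)
          | shiftedBinomial-beyondDegree k 2 (s≤s (s≤s z≤n))
    = zeros n (n ^ 2)
    where
    zeros : ∀ n x → 68 * n * 0 + 24 * x * 0 ≡ 0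
    zeros = ℕSolver.solve-∀


  -- The left-hand sides of the two `expand` lemmas below unfold polyEvalℕ 4, using
  -- shiftedBinomial 0 i j = δᵢⱼ.
  polyEvalℕ-positivePart₀ : ∀ n t → polyEvalℕ 4 (positivePart n 0) t ≡ 24 + 128 * (n * t) ^ 3 + 60 * (n * t) ^ 4
  polyEvalℕ-positivePart₀ = expand
    where
    expand : ∀ n t →
      (24 * 1 + 128 * (n * (n * (n * 1))) * 0 + 60 * (n * (n * (n * (n * 1)))) * 0) +
      (24 * 0 + 128 * (n * (n * (n * 1))) * 0 + 60 * (n * (n * (n * (n * 1)))) * 0) * (t * 1) +
      (24 * 0 + 128 * (n * (n * (n * 1))) * 0 + 60 * (n * (n * (n * (n * 1)))) * 0) * (t * (t * 1)) +
      (24 * 0 + 128 * (n * (n * (n * 1))) * 1 + 60 * (n * (n * (n * (n * 1)))) * 0) * (t * (t * (t * 1))) +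
      (24 * 0 + 128 * (n * (n * (n * 1))) * 0 + 60 * (n * (n * (n * (n * 1)))) * 1) * (t * (t * (t * (t * 1))))
      ≡ 24 + 128 * (n * t * (n * t * (n * t * 1))) + 60 * (n * t * (n * t * (n * t * (n * t * 1))))
    expand = ℕSolver.solve-∀

  polyEvalℕ-negativePart₀ : ∀ n t → polyEvalℕ 4 (negativePart n 0) t ≡ 68 * (n * t) + 24 * (n * t) ^ 2
  polyEvalℕ-negativePart₀ = expand
    where
    expand : ∀ n t →
      (68 * n * 0 + 24 * (n * (n * 1)) * 0) +
      (68 * n * 1 + 24 * (n * (n * 1)) * 0) * (t * 1) +
      (68 * n * 0 + 24 * (n * (n * 1)) * 1) * (t * (t * 1)) +
      (68 * n * 0 + 24 * (n * (n * 1)) * 0) * (t * (t * (t * 1))) +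
      (68 * n * 0 + 24 * (n * (n * 1)) * 0) * (t * (t * (t * (t * 1))))
      ≡ 68 * (n * t) + 24 * (n * t * (n * t * 1))
    expand = ℕSolver.solve-∀

  admissibleCount-polynomial : ∀ n t → 1 ≤ n * t →
    24 * length (admissiblePoints (n * t)) + polyEvalℕ 4 (negativePart n 0) t ≡ polyEvalℕ 4 (positivePart n 0) t
  admissibleCount-polynomial n t 1≤nt = begin
    24 * L + polyEvalℕ 4 (negativePart n 0) t          ≡⟨ cong (_+_ (24 * L)) (polyEvalℕ-negativePart₀ n t) ⟩
    24 * L + (68 * (n * t) + 24 * (n * t) ^ 2)         ≡⟨ admissibleCount (n * t) 1≤nt ⟩
    24 + 128 * (n * t) ^ 3 + 60 * (n * t) ^ 4          ≡⟨ polyEvalℕ-positivePart₀ n t ⟨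
    polyEvalℕ 4 (positivePart n 0) t                   ∎
    where
    open ≡-Reasoning
    L : ℕ
    L = length (admissiblePoints (n * t))

  module _ (K : ℕ) where

    private
      n : ℕ
      n = suc K

    positivePart<negativePart₁ : positivePart n K 1 < negativePart n K 1
    positivePart<negativePart₁ = begin-strict
      24 * (K C 1) + 128 * n ^ 3 * 0 + 60 * n ^ 4 * 0  ≡⟨ cong (λ c → 24 * c + 128 * n ^ 3 * 0 + 60 * n ^ 4 * 0) (nC1≡n K) ⟩
      24 * K + 128 * n ^ 3 * 0 + 60 * n ^ 4 * 0        ≡⟨ dropZeros K (n ^ 3) (n ^ 4) ⟩
      24 * K                                           <⟨ ℕP.m<m+n (24 * K) (s≤s z≤n) ⟩
      24 * K + suc (44 * K + 67)                       ≡⟨ gap K ⟩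
      68 * n * 1 + 24 * n ^ 2 * 0                      ∎
      where
      open ℕP.≤-Reasoning
      dropZeros : ∀ a x y → 24 * a + 128 * x * 0 + 60 * y * 0 ≡ 24 * a
      dropZeros = ℕSolver.solve-∀
      gap : ∀ m → 24 * m + suc (44 * m + 67) ≡ 68 * suc m * 1 + 24 * (suc m * (suc m * 1)) * 0
      gap = ℕSolver.solve-∀

    positivePart<negativePart₂ : positivePart n K 2 < negativePart n K 2
    positivePart<negativePart₂ = begin-strict
      24 * (K C 2) + 128 * n ^ 3 * 0 + 60 * n ^ 4 * 0   ≡⟨ dropZeros (K C 2) (n ^ 3) (n ^ 4) ⟩
      24 * (K C 2)                                      ≤⟨ ℕP.*-monoʳ-≤ 24 (C-suc≤ K 1) ⟩
      24 * (K * (K C 1))                                ≡⟨ cong (λ c → 24 * (K * c)) (nC1≡n K) ⟩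
      24 * (K * K)                                      <⟨ ℕP.m<m+n (24 * (K * K)) (s≤s z≤n) ⟩
      24 * (K * K) + suc (68 * (K * K) + 116 * K + 23)  ≡⟨ gap K ⟩
      68 * n * K + 24 * n ^ 2 * 1                       ≡⟨ cong (λ c → 68 * n * c + 24 * n ^ 2 * 1) (nC1≡n K) ⟨
      68 * n * (K C 1) + 24 * n ^ 2 * 1                 ∎
      where
      open ℕP.≤-Reasoning
      dropZeros : ∀ a x y → 24 * a + 128 * x * 0 + 60 * y * 0 ≡ 24 * a
      dropZeros = ℕSolver.solve-∀
      gap : ∀ m → 24 * (m * m) + suc (68 * (m * m) + 116 * m + 23) ≡ 68 * suc m * m + 24 * (suc m * (suc m * 1)) * 1
      gap = ℕSolver.solve-∀

    negativePart<positivePart : ∀ i → suc i ≤ K → negativePart n K (3 + i) < positivePart n K (3 + i)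
    negativePart<positivePart i 1+i≤K = begin-strict
      68 * n * (K C (2 + i)) + 24 * n ^ 2 * (K C (1 + i))
        ≤⟨ ℕP.+-mono-≤ (ℕP.*-monoʳ-≤ (68 * n) C₂≤) (ℕP.*-monoʳ-≤ (24 * n ^ 2) C₁≤) ⟩
      68 * n * (n * (n * C₀)) + 24 * n ^ 2 * (n * C₀)   ≡⟨ collect n C₀ ⟩
      92 * (n ^ 3 * C₀)                                 <⟨ ℕP.m<m+n (92 * (n ^ 3 * C₀)) 1≤36·n³·C₀ ⟩
      92 * (n ^ 3 * C₀) + 36 * (n ^ 3 * C₀)             ≡⟨ collect′ n C₀ ⟩
      128 * n ^ 3 * C₀                                  ≤⟨ ℕP.m≤n+m (128 * n ^ 3 * C₀) (24 * (K C (3 + i))) ⟩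
      24 * (K C (3 + i)) + 128 * n ^ 3 * C₀             ≤⟨ ℕP.m≤m+n (24 * (K C (3 + i)) + 128 * n ^ 3 * C₀) (60 * n ^ 4 * shiftedBinomial K 4 (3 + i)) ⟩
      positivePart n K (3 + i)                          ∎
      where
      open ℕP.≤-Reasoning
      C₀ : ℕ
      C₀ = K C i
      K≤n : K ≤ n
      K≤n = ℕP.n≤1+n K
      C₁≤ : K C (1 + i) ≤ n * C₀
      C₁≤ = ℕP.≤-trans (C-suc≤ K i) (ℕP.*-monoˡ-≤ C₀ K≤n)
      C₂≤ : K C (2 + i) ≤ n * (n * C₀)
      C₂≤ = ℕP.≤-trans (C-suc≤ K (1 + i)) (ℕP.*-mono-≤ K≤n C₁≤)
      1≤36·n³·C₀ : 1 ≤ 36 * (n ^ 3 * C₀)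
      1≤36·n³·C₀ = ℕP.*-mono-≤ {1} {36} (s≤s z≤n) (ℕP.*-mono-≤ (ℕP.m^n>0 n 3) (C-pos (ℕP.<⇒≤ 1+i≤K)))
      collect : ∀ n c → 68 * n * (n * (n * c)) + 24 * (n * (n * 1)) * (n * c) ≡ 92 * (n * (n * (n * 1)) * c)
      collect = ℕSolver.solve-∀
      collect′ : ∀ n c → 92 * (n * (n * (n * 1)) * c) + 36 * (n * (n * (n * 1)) * c) ≡ 128 * (n * (n * (n * 1))) * c
      collect′ = ℕSolver.solve-∀


module _ where
  open import Data.Rational using (0ℚ; 1ℚ; _+_; _*_; _-_; -_; 1/_; _<_)

  -- Ehrhart polynomials of n𝒜 × [0,1]ᵏ

  ℕ→ℚ-homo-^ : ∀ t k → ℕ→ℚ (t ℕ.^ k) ≡ powQ (ℕ→ℚ t) k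
  ℕ→ℚ-homo-^ t zero    = refl
  ℕ→ℚ-homo-^ t (suc k) = trans (ℕ→ℚ-homo-* t (t ℕ.^ k)) (cong (ℕ→ℚ t *_) (ℕ→ℚ-homo-^ t k))

  ℕ→ℚ-polyEval : ∀ d c t → ℕ→ℚ (polyEvalℕ d c t) ≡ polyEval d (ℕ→ℚ ∘ c) (ℕ→ℚ t)
  ℕ→ℚ-polyEval zero    c t = refl
  ℕ→ℚ-polyEval (suc d) c t = begin
    ℕ→ℚ (polyEvalℕ d c t ℕ.+ c (suc d) ℕ.* t ℕ.^ suc d)
      ≡⟨ ℕ→ℚ-homo-+ (polyEvalℕ d c t) (c (suc d) ℕ.* t ℕ.^ suc d) ⟩
    ℕ→ℚ (polyEvalℕ d c t) + ℕ→ℚ (c (suc d) ℕ.* t ℕ.^ suc d)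
      ≡⟨ cong₂ _+_ (ℕ→ℚ-polyEval d c t)
           (trans (ℕ→ℚ-homo-* (c (suc d)) (t ℕ.^ suc d)) (cong (ℕ→ℚ (c (suc d)) *_) (ℕ→ℚ-homo-^ t (suc d)))) ⟩
    polyEval d (ℕ→ℚ ∘ c) (ℕ→ℚ t) + ℕ→ℚ (c (suc d)) * powQ (ℕ→ℚ t) (suc d) ∎
    where open ≡-Reasoning

  polyEval-cong : ∀ d {c c′ : ℕ → ℚ} x → (∀ j → c j ≡ c′ j) → polyEval d c x ≡ polyEval d c′ x
  polyEval-cong zero    x c≗c′ = c≗c′ 0
  polyEval-cong (suc d) x c≗c′ =
    cong₂ _+_ (polyEval-cong d x c≗c′) (cong (_* powQ x (suc d)) (c≗c′ (suc d)))

  polyEval-scaledDifference : ∀ d (a b : ℕ → ℚ) w x →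
    polyEval d (λ j → (a j - b j) * w) x ≡ (polyEval d a x - polyEval d b x) * w
  polyEval-scaledDifference zero    a b w x = refl
  polyEval-scaledDifference (suc d) a b w x =
    trans (cong (_+ (a (suc d) - b (suc d)) * w * powQ x (suc d)) (polyEval-scaledDifference d a b w x))
          (linear (polyEval d a x) (polyEval d b x) (a (suc d)) (b (suc d)) w (powQ x (suc d)))
    where
    linear : ∀ A B a b w p → (A - B) * w + (a - b) * w * p ≡ (A + a * p - (B + b * p)) * w
    linear = solve-∀ ℚ-ring

  times1+t : (ℕ → ℚ) → ℕ → ℚ
  times1+t c zero    = c zero
  times1+t c (suc j) = c (suc j) + c j

  polyEval-times1+t′ : ∀ d c x →
    polyEval d (times1+t c) x ≡ polyEval d c x * (1ℚ + x) - c d * powQ x (suc d)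
  polyEval-times1+t′ zero    c x = expand (c 0) x
    where
    expand : ∀ c x → c ≡ c * (1ℚ + x) - c * (x * 1ℚ)
    expand = solve-∀ ℚ-ring
  polyEval-times1+t′ (suc d) c x =
    trans (cong (_+ (c (suc d) + c d) * powQ x (suc d)) (polyEval-times1+t′ d c x))
          (expand (polyEval d c x) (c d) (c (suc d)) (powQ x (suc d)) x)
    where
    expand : ∀ P c c′ p x → P * (1ℚ + x) - c * p + (c′ + c) * p ≡
                            (P + c′ * p) * (1ℚ + x) - c′ * (x * p)
    expand = solve-∀ ℚ-ring

  polyEval-times1+t : ∀ d c x → c (suc d) ≡ 0ℚ →
    polyEval (suc d) (times1+t c) x ≡ polyEval d c x * (1ℚ + x)
  polyEval-times1+t d c x c[1+d]≡0 = begin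
    polyEval d (times1+t c) x + (c (suc d) + c d) * powQ x (suc d)
      ≡⟨ cong₂ (λ P c′ → P + (c′ + c d) * powQ x (suc d)) (polyEval-times1+t′ d c x) c[1+d]≡0 ⟩
    polyEval d c x * (1ℚ + x) - c d * powQ x (suc d) + (0ℚ + c d) * powQ x (suc d)
      ≡⟨ cancel (polyEval d c x * (1ℚ + x)) (c d) (powQ x (suc d)) ⟩
    polyEval d c x * (1ℚ + x) ∎
    where
    open ≡-Reasoning
    cancel : ∀ A c p → A - c * p + (0ℚ + c) * p ≡ A
    cancel = solve-∀ ℚ-ring

  ehrhartCoefficient : ℕ → ℕ → ℕ → ℚ
  ehrhartCoefficient n k j = (ℕ→ℚ (positivePart n k j) - ℕ→ℚ (negativePart n k j)) * 1/ ℕ→ℚ 24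

  ehrhartCoefficient-suc : ∀ n k j → ehrhartCoefficient n (suc k) j ≡ times1+t (ehrhartCoefficient n k) j
  ehrhartCoefficient-suc n k zero    =
    cong₂ (λ p q → (ℕ→ℚ p - ℕ→ℚ q) * 1/ ℕ→ℚ 24) (positivePart-suc₀ n k) (negativePart-suc₀ n k)
  ehrhartCoefficient-suc n k (suc j) = begin
    (ℕ→ℚ (positivePart n (suc k) (suc j)) - ℕ→ℚ (negativePart n (suc k) (suc j))) * w
      ≡⟨ cong₂ (λ p q → (p - q) * w)
           (trans (cong ℕ→ℚ (positivePart-pascal n k j)) (ℕ→ℚ-homo-+ (positivePart n k (suc j)) (positivePart n k j)))
           (trans (cong ℕ→ℚ (negativePart-pascal n k j)) (ℕ→ℚ-homo-+ (negativePart n k (suc j)) (negativePart n k j))) ⟩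
    (ℕ→ℚ (positivePart n k (suc j)) + ℕ→ℚ (positivePart n k j) -
     (ℕ→ℚ (negativePart n k (suc j)) + ℕ→ℚ (negativePart n k j))) * w
      ≡⟨ split (ℕ→ℚ (positivePart n k (suc j))) (ℕ→ℚ (positivePart n k j))
               (ℕ→ℚ (negativePart n k (suc j))) (ℕ→ℚ (negativePart n k j)) w ⟩
    ehrhartCoefficient n k (suc j) + ehrhartCoefficient n k j ∎
    where
    open ≡-Reasoning
    w : ℚ
    w = 1/ ℕ→ℚ 24
    split : ∀ a a′ b b′ w → (a + a′ - (b + b′)) * w ≡ (a - b) * w + (a′ - b′) * w
    split = solve-∀ ℚ-ring

  ehrhartCoefficient-beyondDegree : ∀ n k → ehrhartCoefficient n k (suc (4 ℕ.+ k)) ≡ 0ℚ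
  ehrhartCoefficient-beyondDegree n k = cong₂ (λ p q → (ℕ→ℚ p - ℕ→ℚ q) * 1/ ℕ→ℚ 24)
    (positivePart-beyondDegree n k) (negativePart-beyondDegree n k)

  latticeCount-dilate-𝒜 : ∀ n .{{_ : ℕ.NonZero n}} t → 1 ℕ.≤ t →
    LatticeCount (dilate n 𝒜) t (polyEval 4 (ehrhartCoefficient n 0) (ℕ→ℚ t))
  latticeCount-dilate-𝒜 n t 1≤t =
    subst (LatticeCount (dilate n 𝒜) t) |T𝒜|≡polynomial
      (latticeCount-cong {P = 𝒜} {Q = dilate n 𝒜} {s = n ℕ.* t} {t = t} (inDilate-dilate n 𝒜 t) (latticeCount-𝒜 (n ℕ.* t)))
    where
    open ≡-Reasoning
    L : ℕ
    L = length (admissiblePoints (n ℕ.* t))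
    N : ℕ
    N = polyEvalℕ 4 (negativePart n 0) t
    w : ℚ
    w = 1/ ℕ→ℚ 24
    solveFor : ∀ L N → L ≡ (ℕ→ℚ 24 * L + N - N) * 1/ ℕ→ℚ 24
    solveFor = solve-∀ ℚ-ring
    |T𝒜|≡polynomial : ℕ→ℚ L ≡ polyEval 4 (ehrhartCoefficient n 0) (ℕ→ℚ t)
    |T𝒜|≡polynomial = begin
      ℕ→ℚ L
        ≡⟨ solveFor (ℕ→ℚ L) (ℕ→ℚ N) ⟩
      (ℕ→ℚ 24 * ℕ→ℚ L + ℕ→ℚ N - ℕ→ℚ N) * w
        ≡⟨ cong (λ p → (p - ℕ→ℚ N) * w)
             (sym (trans (ℕ→ℚ-homo-+ (24 ℕ.* L) N) (cong (_+ ℕ→ℚ N) (ℕ→ℚ-homo-* 24 L)))) ⟩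
      (ℕ→ℚ (24 ℕ.* L ℕ.+ N) - ℕ→ℚ N) * w
        ≡⟨ cong (λ p → (ℕ→ℚ p - ℕ→ℚ N) * w) (admissibleCount-polynomial n t (ℕP.*-mono-≤ (ℕ.>-nonZero⁻¹ n) 1≤t)) ⟩
      (ℕ→ℚ (polyEvalℕ 4 (positivePart n 0) t) - ℕ→ℚ N) * w
        ≡⟨ cong₂ (λ p q → (p - q) * w) (ℕ→ℚ-polyEval 4 (positivePart n 0) t) (ℕ→ℚ-polyEval 4 (negativePart n 0) t) ⟩
      (polyEval 4 (ℕ→ℚ ∘ positivePart n 0) (ℕ→ℚ t) - polyEval 4 (ℕ→ℚ ∘ negativePart n 0) (ℕ→ℚ t)) * w
        ≡⟨ polyEval-scaledDifference 4 (ℕ→ℚ ∘ positivePart n 0) (ℕ→ℚ ∘ negativePart n 0) w (ℕ→ℚ t) ⟨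
      polyEval 4 (ehrhartCoefficient n 0) (ℕ→ℚ t) ∎

  ehrhartPolytope : ℕ → (k : ℕ) → IntPolytope (4 ℕ.+ k)
  ehrhartPolytope n zero    = dilate n 𝒜
  ehrhartPolytope n (suc k) = prism (ehrhartPolytope n k)

  ehrhartPolytope-ehrhart : ∀ n .{{_ : ℕ.NonZero n}} k →
    IsEhrhartPoly (ehrhartPolytope n k) (4 ℕ.+ k) (ehrhartCoefficient n k)
  ehrhartPolytope-ehrhart n zero    t 1≤t = latticeCount-dilate-𝒜 n t 1≤t
  ehrhartPolytope-ehrhart n (suc k) t 1≤t =
    subst (LatticeCount (ehrhartPolytope n (suc k)) t) (sym times1+t-polynomial)
      (latticeCount-prism (ehrhartPolytope n k) 1≤t (ehrhartPolytope-ehrhart n k t 1≤t))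
    where
    times1+t-polynomial : polyEval (suc (4 ℕ.+ k)) (ehrhartCoefficient n (suc k)) (ℕ→ℚ t) ≡
                          polyEval (4 ℕ.+ k) (ehrhartCoefficient n k) (ℕ→ℚ t) * (1ℚ + ℕ→ℚ t)
    times1+t-polynomial = trans (polyEval-cong (suc (4 ℕ.+ k)) (ℕ→ℚ t) (ehrhartCoefficient-suc n k))
      (polyEval-times1+t (4 ℕ.+ k) (ehrhartCoefficient n k) (ℕ→ℚ t) (ehrhartCoefficient-beyondDegree n k))

  ehrhartPolytope-affIndep : ∀ n .{{_ : ℕ.NonZero n}} k →
    Σ (Fin (suc (4 ℕ.+ k)) → Fin (m (ehrhartPolytope n k))) λ f → AffIndep (gens (ehrhartPolytope n k) ∘ f)
  ehrhartPolytope-affIndep n zero    = (λ i → i) , affIndep-dilate n 𝒜 (λ i → i) affIndep-vertex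
  ehrhartPolytope-affIndep n (suc k) with ehrhartPolytope-affIndep n k
  ... | f , indep = prismLift (ehrhartPolytope n k) f , affIndep-prism (ehrhartPolytope n k) f indep

  scaledDifference-negative : ∀ {a b} → a ℕ.< b → (ℕ→ℚ a - ℕ→ℚ b) * 1/ ℕ→ℚ 24 < 0ℚ
  scaledDifference-negative {a} {b} a<b = begin-strict
    (ℕ→ℚ a - ℕ→ℚ b) * w  <⟨ ℚP.*-monoˡ-<-pos w a-b<0 ⟩
    0ℚ * w               ≡⟨ ℚP.*-zeroˡ w ⟩
    0ℚ                    ∎
    where
    open ℚP.≤-Reasoning
    w : ℚ
    w = 1/ ℕ→ℚ 24
    a-b<0 : ℕ→ℚ a - ℕ→ℚ b < 0ℚ
    a-b<0 = subst (ℕ→ℚ a - ℕ→ℚ b <_) (ℚP.+-inverseʳ (ℕ→ℚ b)) (ℚP.+-monoˡ-< (- ℕ→ℚ b) (ℕ→ℚ-mono-< a<b))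

  scaledDifference-positive : ∀ {a b} → b ℕ.< a → 0ℚ < (ℕ→ℚ a - ℕ→ℚ b) * 1/ ℕ→ℚ 24
  scaledDifference-positive {a} {b} b<a = begin-strict
    0ℚ                    ≡⟨ ℚP.*-zeroˡ w ⟨
    0ℚ * w               <⟨ ℚP.*-monoˡ-<-pos w 0<a-b ⟩
    (ℕ→ℚ a - ℕ→ℚ b) * w  ∎
    where
    open ℚP.≤-Reasoning
    w : ℚ
    w = 1/ ℕ→ℚ 24
    0<a-b : 0ℚ < ℕ→ℚ a - ℕ→ℚ b
    0<a-b = subst (_< ℕ→ℚ a - ℕ→ℚ b) (ℚP.+-inverseʳ (ℕ→ℚ b)) (ℚP.+-monoˡ-< (- ℕ→ℚ b) (ℕ→ℚ-mono-< b<a))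

open import Data.Nat using (ℕ; _≤_; _∸_)
open import Data.Rational using (ℚ; 0ℚ) renaming (_<_ to _<ℚ_)

theorem4p3 : (d : ℕ) → 4 ≤ d →
    Σ ℕ λ N → Σ (IntPolytope N) λ P → HasDim P d ×
    Σ (ℕ → ℚ) λ c → IsEhrhartPoly P d c ×
    (c 1 <ℚ 0ℚ) × (c 2 <ℚ 0ℚ) ×
    (∀ k → 3 ≤ k → k ≤ d ∸ 2 → 0ℚ <ℚ c k)
theorem4p3 _ (s≤s (s≤s (s≤s (s≤s (z≤n {K}))))) =
  4 ℕ.+ K , P ,
  (ehrhartPolytope-affIndep (suc K) K , λ f → ¬AffIndep-d+2-points (4 ℕ.+ K) (gens P ∘ f)) ,
  ehrhartCoefficient (suc K) K , ehrhartPolytope-ehrhart (suc K) K ,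
  scaledDifference-negative (positivePart<negativePart₁ K) ,
  scaledDifference-negative (positivePart<negativePart₂ K) ,
  middleCoefficients
  where
  P : IntPolytope (4 ℕ.+ K)
  P = ehrhartPolytope (suc K) K
  middleCoefficients : ∀ k → 3 ≤ k → k ≤ 2 ℕ.+ K → 0ℚ <ℚ ehrhartCoefficient (suc K) K k
  middleCoefficients (suc (suc (suc i))) (s≤s (s≤s (s≤s z≤n))) (s≤s (s≤s 1+i≤K)) = scaledDifference-positive (negativePart<positivePart K i 1+i≤K)
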